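{- Let $G$ be a connected simple graph. The following are equivalent: (1) the Smith normal form of $A(G)$ has at most 2 invariant factors equal to 1; (2) $G$ contains none of $P_4$, the paw, and $K_4$ as an induced subgraph; (3) $G$ is an induced subgraph of a complete tripartite graph.
   Context: $A(G)$ is the adjacency matrix of $G$; the Smith normal form is taken over $\mathbb{Z}$. $P_4$ is the path on 4 vertices and the paw is a triangle with one pendant vertex attached. -}

module Defs where

open import Data.Nat using (ℕ; zero; suc; _≤_)
import Data.Nat as ℕ
open import Data.Bool using (Bool; true; false; not; _∨_; _∧_; if_then_else_)
open import Data.Fin using (Fin; toℕ; splitAt) renaming (zero to fz; suc to fs)
import Data.Fin as Fin
open import Data.Integer using (ℤ; +_; 0ℤ; 1ℤ) renaming (_+_ to _+ℤ_; _*_ to _*ℤ_; _≤_ to _≤ℤ_)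
import Data.Integer as ℤ
open import Data.Integer.Divisibility using (_∣_)
open import Data.Sum using (_⊎_; inj₁; inj₂)
open import Data.Product using (Σ; _×_; _,_; ∃; ∃-syntax)
open import Function.Definitions using (Injective)
open import Relation.Binary.PropositionalEquality using (_≡_)
open import Relation.Nullary.Decidable using (⌊_⌋)

record Graph (n : ℕ) : Set where
  field
    adj    : Fin n → Fin n → Bool
    sym    : ∀ i j → adj i j ≡ adj j i
    irrefl : ∀ i → adj i i ≡ false
open Graph public

data Walk {n : ℕ} (G : Graph n) : Fin n → Fin n → Set where
  here : ∀ {i} → Walk G i i
  step : ∀ {i j k} → adj G i j ≡ true → Walk G j k → Walk G i k

Connected : ∀ {n} → Graph n → Set
Connected {n} G = ∀ (i j : Fin n) → Walk G i j

InducedSubgraphOf : ∀ {m n} → (Fin m → Fin m → Bool) → (Fin n → Fin n → Bool) → Set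
InducedSubgraphOf {m} {n} H G =
  Σ (Fin m → Fin n) λ f → Injective _≡_ _≡_ f × (∀ i j → G (f i) (f j) ≡ H i j)

sym-closure : (ℕ → ℕ → Bool) → Fin 4 → Fin 4 → Bool
sym-closure E i j = E (toℕ i) (toℕ j) ∨ E (toℕ j) (toℕ i)

P4-edge : ℕ → ℕ → Bool
P4-edge 0 1 = true
P4-edge 1 2 = true
P4-edge 2 3 = true
P4-edge _ _ = false

P4 : Fin 4 → Fin 4 → Bool
P4 = sym-closure P4-edge

paw-edge : ℕ → ℕ → Bool
paw-edge 0 1 = true
paw-edge 0 2 = true
paw-edge 1 2 = true
paw-edge 0 3 = true
paw-edge _ _ = false

paw : Fin 4 → Fin 4 → Bool
paw = sym-closure paw-edge

K4 : Fin 4 → Fin 4 → Bool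
K4 i j = not ⌊ i Fin.≟ j ⌋

part3 : ∀ a b c → Fin (a ℕ.+ b ℕ.+ c) → Fin 3
part3 a b c x with splitAt (a ℕ.+ b) x
... | inj₂ _ = fs (fs fz)
... | inj₁ y with splitAt a y
...   | inj₁ _ = fz
...   | inj₂ _ = fs fz

completeTripartite : ∀ a b c → Fin (a ℕ.+ b ℕ.+ c) → Fin (a ℕ.+ b ℕ.+ c) → Bool
completeTripartite a b c x y = not ⌊ part3 a b c x Fin.≟ part3 a b c y ⌋

InducedSubgraphOfCompleteTripartite : ∀ {n} → Graph n → Set
InducedSubgraphOfCompleteTripartite G =
  ∃[ a ] ∃[ b ] ∃[ c ] (1 ≤ a × 1 ≤ b × 1 ≤ c ×
    InducedSubgraphOf (adj G) (completeTripartite a b c))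

Matrix : ℕ → Set
Matrix n = Fin n → Fin n → ℤ

sumFin : ∀ {n} → (Fin n → ℤ) → ℤ
sumFin {zero}  f = 0ℤ
sumFin {suc n} f = f fz +ℤ sumFin (λ i → f (fs i))

countFin : ∀ {n} → (Fin n → Bool) → ℕ
countFin {zero}  p = 0
countFin {suc n} p = (if p fz then 1 else 0) ℕ.+ countFin (λ i → p (fs i))

_⊗_ : ∀ {n} → Matrix n → Matrix n → Matrix n
(M ⊗ N) i k = sumFin (λ j → M i j *ℤ N j k)

identity : ∀ {n} → Matrix n
identity i j = if ⌊ i Fin.≟ j ⌋ then 1ℤ else 0ℤ

diag : ∀ {n} → (Fin n → ℤ) → Matrix n
diag d i j = if ⌊ i Fin.≟ j ⌋ then d i else 0ℤ

_≐_ : ∀ {n} → Matrix n → Matrix n → Set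
M ≐ N = ∀ i j → M i j ≡ N i j

Unimodular : ∀ {n} → Matrix n → Set
Unimodular {n} P = Σ (Matrix n) λ P' → ((P ⊗ P') ≐ identity) × ((P' ⊗ P) ≐ identity)

adjMatrix : ∀ {n} → Graph n → Matrix n
adjMatrix G i j = if adj G i j then 1ℤ else 0ℤ

IsSmithNormalForm : ∀ {n} → Matrix n → (Fin n → ℤ) → Set
IsSmithNormalForm {n} M d =
  (∀ i → 0ℤ ≤ℤ d i) ×
  (∀ (i j : Fin n) → toℕ i ≤ toℕ j → d i ∣ d j) ×
  Σ (Matrix n) λ P → Σ (Matrix n) λ Q →
    Unimodular P × Unimodular Q × (((P ⊗ M) ⊗ Q) ≐ diag d)

numUnitInvariantFactors : ∀ {n} → (Fin n → ℤ) → ℕ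
numUnitInvariantFactors d = countFin (λ i → ⌊ d i ℤ.≟ 1ℤ ⌋)

SNFAtMostTwoOnes : ∀ {n} → Graph n → Set
SNFAtMostTwoOnes {n} G =
  Σ (Fin n → ℤ) λ d → IsSmithNormalForm (adjMatrix G) d × numUnitInvariantFactors d ≤ 2

{-# OPTIONS --safe #-}
module Submission where

-- If the Smith normal form of A(G) has at most two invariant factors equal to 1, its third invariant
-- factor m is not 1, and A(G) is congruent modulo m to a matrix of rank at most 2 (the first two
-- terms of P⁻¹ diag(d) Q⁻¹), so m divides every 3×3 minor of A(G). Each of P4, the paw and K4 has a
-- 3×3 minor equal to ±1, so none of them is an induced subgraph.
--
-- In a connected graph without induced P4 or paw, non-adjacency is transitive: a walk from a
-- common non-neighbour of an edge xy to x leaves the common non-neighbourhood along an edge uv, and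
-- u, v, x, y induce a P4 or a paw. Hence the graph is complete multipartite; a maximal clique has one
-- vertex in each part, so without K4 there are at most three parts. This gives an induced
-- subgraph of a complete tripartite graph, and conversely every such graph has transitive
-- non-adjacency and no K4, which excludes all three graphs.
--
-- For the Smith normal form of a complete k-partite graph (k ≤ 3), move one representative of each
-- part to the front, subtract from every other row and column the one of its representative, and
-- reduce the remaining block A(K_k) ⊕ 0: the result is diag(1, 1, 2, 0, …, 0), diag(1, 1, 0, …, 0)
-- or 0 according as k = 3, k = 2 or k ≤ 1.

import Data.Integer.Properties as ℤ
open import Algebra.Properties.Semiring.Sum ℤ.+-*-semiring
  using (sum; sum-cong-≗; sum-replicate-zero; ∑-comm; ∑-distrib-+; *-distribˡ-sum; *-distribʳ-sum)
open import Data.Bool using (Bool; true; false; not; if_then_else_)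
import Data.Bool as Bool
import Data.Bool.Properties as BoolP
open import Data.Empty using (⊥; ⊥-elim)
open import Data.Fin using (Fin; toℕ; _↑ˡ_; _↑ʳ_; splitAt) renaming (zero to fz; suc to fs)
import Data.Fin as Fin
open import Data.Fin.Patterns using (0F; 1F; 2F; 3F)
import Data.Fin.Permutation as Perm
open import Data.Fin.Permutation using (Permutation′; _⟨$⟩ʳ_; _⟨$⟩ˡ_; _∘ₚ_)
import Data.Fin.Permutation.Components as PC
import Data.Fin.Properties as FinP
open import Data.Integer using (ℤ; +_; 0ℤ; 1ℤ; -1ℤ; _+_; _*_; -_; _-_; ∣_∣)
import Data.Integer as ℤ
open import Data.Integer.Divisibility using (_∣_)
open import Data.Integer.Divisibility.Signed
  using (∣m∣n⇒∣m+n; ∣m∣n⇒∣m-n; ∣n⇒∣m*n; ∣m⇒∣m*n; ∣ᵤ⇒∣; ∣⇒∣ᵤ) renaming (_∣_ to _∣ₛ_)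
open import Data.Integer.Properties using (+-identityˡ; +-identityʳ; +-assoc; *-identityˡ; *-identityʳ; *-zeroʳ; *-assoc)
open import Data.Integer.Tactic.RingSolver using (solve-∀)
open import Data.Nat using (ℕ; zero; suc; z≤n; s≤s; _≤_)
import Data.Nat as ℕ
import Data.Nat.Divisibility as ℕD
import Data.Nat.Properties as ℕ
open import Data.Product using (Σ; ∃; _×_; _,_; proj₁; proj₂)
open import Data.Sum using (_⊎_; inj₁; inj₂)
open import Data.Vec using (Vec; _∷_; [])
import Data.Vec as Vec
open import Data.Vec.Functional using (_++_) renaming (_∷_ to _∷ᶠ_)
open import Data.Vec.Functional.Properties using (lookup-++ˡ; lookup-++ʳ)
open import Defs hiding (sym)
open import Function using (_∘_; case_of_)
open import Function.Bundles using (_⇔_; mk⇔)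
open import Function.Definitions using (Injective)
open import Relation.Binary.Bundles using (Setoid)
open import Relation.Binary.PropositionalEquality
  using (_≡_; _≢_; _≗_; refl; sym; trans; cong; cong₂; cong-app; subst; subst₂; module ≡-Reasoning)
import Relation.Binary.Reasoning.Setoid
open import Relation.Binary.Structures using (IsEquivalence)
open import Relation.Nullary using (¬_; Dec; yes; no)
open import Relation.Nullary.Decidable
  using (⌊_⌋; isYes≗does; dec-true; dec-false; from-yes; True; toWitness; _→-dec_; _⊎-dec_; ¬?)

indicator : Bool → ℤ
indicator b = if b then 1ℤ else 0ℤ

⌊≟⌋-injective : ∀ {k n} {f : Fin k → Fin n} → Injective _≡_ _≡_ f →
  ∀ a c → ⌊ f a FinP.≟ f c ⌋ ≡ ⌊ a FinP.≟ c ⌋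
⌊≟⌋-injective {f = f} f-inj a c with a FinP.≟ c | f a FinP.≟ f c
... | yes refl | yes _     = refl
... | yes refl | no fa≢fa  = ⊥-elim (fa≢fa refl)
... | no a≢c   | yes fa≡fc = ⊥-elim (a≢c (f-inj fa≡fc))
... | no _     | no _      = refl

⌊≟⌋-distinct : ∀ {n} {i j : Fin n} → i ≢ j → ⌊ i FinP.≟ j ⌋ ≡ false
⌊≟⌋-distinct {i = i} {j} i≢j = trans (isYes≗does (i FinP.≟ j)) (dec-false (i FinP.≟ j) i≢j)

↑ˡ≢↑ʳ : ∀ {k m} (a : Fin k) (b : Fin m) → a ↑ˡ m ≢ k ↑ʳ b
↑ˡ≢↑ʳ {k} {m} a b eq
  with () ← trans (sym (FinP.splitAt-↑ˡ k a m)) (trans (cong (splitAt k) eq) (FinP.splitAt-↑ʳ k m b))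

completeGraph : ∀ k → Fin k → Fin k → Bool
completeGraph k i j = not ⌊ i FinP.≟ j ⌋

completeGraph≡false⇒≡ : ∀ {k} {a c : Fin k} → completeGraph k a c ≡ false → a ≡ c
completeGraph≡false⇒≡ {a = a} {c} K≡false with a FinP.≟ c
... | yes a≡c = a≡c

≡⇒completeGraph≡false : ∀ {k} {a c : Fin k} → a ≡ c → completeGraph k a c ≡ false
≡⇒completeGraph≡false {a = a} refl = cong not (trans (isYes≗does (a FinP.≟ a)) (dec-true (a FinP.≟ a) refl))

-- Matrices over ℤ

δ : ∀ {n} → Matrix n
δ = identity

δ-suc : ∀ {n} (i j : Fin n) → δ (fs i) (fs j) ≡ δ i j
δ-suc i j = cong indicator (⌊≟⌋-injective FinP.suc-injective i j)

sumFin≡sum : ∀ {n} (f : Fin n → ℤ) → sumFin f ≡ sum f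
sumFin≡sum {zero}  f = refl
sumFin≡sum {suc n} f = cong (_+_ (f fz)) (sumFin≡sum (f ∘ fs))

sum-zero : ∀ {n} {f : Fin n → ℤ} → (∀ i → f i ≡ 0ℤ) → sum f ≡ 0ℤ
sum-zero {n} f≗0 = trans (sum-cong-≗ f≗0) (sum-replicate-zero n)

sum-δˡ : ∀ {n} (i : Fin n) (g : Fin n → ℤ) → sum (λ j → δ i j * g j) ≡ g i
sum-δˡ fz g =
  trans (cong₂ _+_ (*-identityˡ (g fz)) (sum-zero {f = λ j → 0ℤ * g (fs j)} (λ j → refl))) (+-identityʳ (g fz))
sum-δˡ (fs i) g = begin
  0ℤ * g fz + sum (λ j → δ (fs i) (fs j) * g (fs j)) ≡⟨ +-identityˡ _ ⟩
  sum (λ j → δ (fs i) (fs j) * g (fs j))           ≡⟨ sum-cong-≗ (λ j → cong (_* g (fs j)) (δ-suc i j)) ⟩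
  sum (λ j → δ i j * g (fs j))                     ≡⟨ sum-δˡ i (g ∘ fs) ⟩
  g (fs i)                                         ∎
  where open ≡-Reasoning

sum-δʳ : ∀ {n} (i : Fin n) (g : Fin n → ℤ) → sum (λ j → g j * δ j i) ≡ g i
sum-δʳ fz g = trans (cong₂ _+_ (*-identityʳ (g fz)) (sum-zero {f = λ j → g (fs j) * 0ℤ} (λ j → *-zeroʳ (g (fs j)))))
                    (+-identityʳ (g fz))
sum-δʳ (fs i) g = begin
  g fz * 0ℤ + sum (λ j → g (fs j) * δ (fs j) (fs i)) ≡⟨ cong (_+ sum (λ j → g (fs j) * δ (fs j) (fs i))) (*-zeroʳ (g fz)) ⟩
  0ℤ + sum (λ j → g (fs j) * δ (fs j) (fs i))        ≡⟨ +-identityˡ _ ⟩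
  sum (λ j → g (fs j) * δ (fs j) (fs i))             ≡⟨ sum-cong-≗ (λ j → cong (g (fs j) *_) (δ-suc j i)) ⟩
  sum (λ j → g (fs j) * δ j i)                       ≡⟨ sum-δʳ i (g ∘ fs) ⟩
  g (fs i)                                           ∎
  where open ≡-Reasoning

sum-rowOperation : ∀ {n} (x r : Fin n) (c : ℤ) (g : Fin n → ℤ) →
  sum (λ z → (δ x z + c * δ r z) * g z) ≡ g x + c * g r
sum-rowOperation x r c g = begin
  sum (λ z → (δ x z + c * δ r z) * g z)                    ≡⟨ sum-cong-≗ (λ z → distrib (δ x z) (δ r z) c (g z)) ⟩
  sum (λ z → δ x z * g z + c * (δ r z * g z))              ≡⟨ ∑-distrib-+ (λ z → δ x z * g z) (λ z → c * (δ r z * g z)) ⟩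
  sum (λ z → δ x z * g z) + sum (λ z → c * (δ r z * g z))
    ≡⟨ cong₂ _+_ (sum-δˡ x g) (trans (sym (*-distribˡ-sum c (λ z → δ r z * g z))) (cong (c *_) (sum-δˡ r g))) ⟩
  g x + c * g r                                            ∎
  where
  open ≡-Reasoning
  distrib : ∀ a b c t → (a + c * b) * t ≡ a * t + c * (b * t)
  distrib = solve-∀

sum-columnOperation : ∀ {n} (y r : Fin n) (c : ℤ) (g : Fin n → ℤ) →
  sum (λ z → g z * (δ z y + c * δ z r)) ≡ g y + c * g r
sum-columnOperation y r c g = begin
  sum (λ z → g z * (δ z y + c * δ z r))                    ≡⟨ sum-cong-≗ (λ z → distrib (δ z y) (δ z r) c (g z)) ⟩
  sum (λ z → g z * δ z y + c * (g z * δ z r))              ≡⟨ ∑-distrib-+ (λ z → g z * δ z y) (λ z → c * (g z * δ z r)) ⟩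
  sum (λ z → g z * δ z y) + sum (λ z → c * (g z * δ z r))
    ≡⟨ cong₂ _+_ (sum-δʳ y g) (trans (sym (*-distribˡ-sum c (λ z → g z * δ z r))) (cong (c *_) (sum-δʳ r g))) ⟩
  g y + c * g r                                            ∎
  where
  open ≡-Reasoning
  distrib : ∀ a b c t → t * (a + c * b) ≡ t * a + c * (t * b)
  distrib = solve-∀

sum-↑ : ∀ k {m} (f : Fin (k ℕ.+ m) → ℤ) → sum f ≡ sum (λ a → f (a ↑ˡ m)) + sum (λ b → f (k ↑ʳ b))
sum-↑ zero    f = sym (+-identityˡ (sum f))
sum-↑ (suc k) f = trans (cong (_+_ (f fz)) (sum-↑ k (f ∘ fs))) (sym (+-assoc (f fz) _ _))

sum-∣ : ∀ {n} {m : ℤ} (f : Fin n → ℤ) → (∀ l → m ∣ₛ f l) → m ∣ₛ sum f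
sum-∣ {zero}  f m∣f = ∣ᵤ⇒∣ (ℕD._∣0 _)
sum-∣ {suc n} f m∣f = ∣m∣n⇒∣m+n (m∣f fz) (sum-∣ (f ∘ fs) (m∣f ∘ fs))

*-annihilateˡ : ∀ {a} b → a ≡ 0ℤ → a * b ≡ 0ℤ
*-annihilateˡ b refl = refl

*-annihilateʳ : ∀ a {b} → b ≡ 0ℤ → a * b ≡ 0ℤ
*-annihilateʳ a refl = *-zeroʳ a

⊗-sum : ∀ {n} (M N : Matrix n) i k → (M ⊗ N) i k ≡ sum (λ j → M i j * N j k)
⊗-sum M N i k = sumFin≡sum (λ j → M i j * N j k)

≐-isEquivalence : ∀ {n} → IsEquivalence (_≐_ {n})
≐-isEquivalence = record
  { refl  = λ i j → refl
  ; sym   = λ M≐N i j → sym (M≐N i j)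
  ; trans = λ M≐N N≐K i j → trans (M≐N i j) (N≐K i j)
  }

≐-setoid : ℕ → Setoid _ _
≐-setoid n = record { isEquivalence = ≐-isEquivalence {n} }

module ≐ {n : ℕ} = IsEquivalence (≐-isEquivalence {n})
module ≐-Reasoning {n : ℕ} = Relation.Binary.Reasoning.Setoid (≐-setoid n)

⊗-cong : ∀ {n} {A A' B B' : Matrix n} → A ≐ A' → B ≐ B' → (A ⊗ B) ≐ (A' ⊗ B')
⊗-cong {A = A} {A'} {B} {B'} A≐A' B≐B' i k = begin
  (A ⊗ B) i k                 ≡⟨ ⊗-sum A B i k ⟩
  sum (λ j → A i j * B j k)   ≡⟨ sum-cong-≗ (λ j → cong₂ _*_ (A≐A' i j) (B≐B' j k)) ⟩
  sum (λ j → A' i j * B' j k) ≡⟨ ⊗-sum A' B' i k ⟨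
  (A' ⊗ B') i k               ∎
  where open ≡-Reasoning

⊗-congˡ : ∀ {n} (A : Matrix n) {B B'} → B ≐ B' → (A ⊗ B) ≐ (A ⊗ B')
⊗-congˡ A = ⊗-cong (≐.refl {x = A})

⊗-congʳ : ∀ {n} (B : Matrix n) {A A'} → A ≐ A' → (A ⊗ B) ≐ (A' ⊗ B)
⊗-congʳ B A≐A' = ⊗-cong A≐A' (≐.refl {x = B})

⊗-assoc : ∀ {n} (A B C : Matrix n) → ((A ⊗ B) ⊗ C) ≐ (A ⊗ (B ⊗ C))
⊗-assoc A B C i l = begin
  ((A ⊗ B) ⊗ C) i l                                  ≡⟨ ⊗-sum (A ⊗ B) C i l ⟩
  sum (λ k → (A ⊗ B) i k * C k l)                    ≡⟨ sum-cong-≗ (λ k → cong (_* C k l) (⊗-sum A B i k)) ⟩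
  sum (λ k → sum (λ j → A i j * B j k) * C k l)      ≡⟨ sum-cong-≗ (λ k → *-distribʳ-sum (C k l) (λ j → A i j * B j k)) ⟩
  sum (λ k → sum (λ j → A i j * B j k * C k l))      ≡⟨ ∑-comm (λ k j → A i j * B j k * C k l) ⟩
  sum (λ j → sum (λ k → A i j * B j k * C k l))      ≡⟨ sum-cong-≗ (λ j → sum-cong-≗ (λ k → *-assoc (A i j) (B j k) _)) ⟩
  sum (λ j → sum (λ k → A i j * (B j k * C k l)))    ≡⟨ sum-cong-≗ (λ j → *-distribˡ-sum (A i j) (λ k → B j k * C k l)) ⟨
  sum (λ j → A i j * sum (λ k → B j k * C k l))      ≡⟨ sum-cong-≗ (λ j → cong (A i j *_) (⊗-sum B C j l)) ⟨
  sum (λ j → A i j * (B ⊗ C) j l)                    ≡⟨ ⊗-sum A (B ⊗ C) i l ⟨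
  (A ⊗ (B ⊗ C)) i l                                  ∎
  where open ≡-Reasoning

⊗-identityˡ : ∀ {n} (M : Matrix n) → (identity ⊗ M) ≐ M
⊗-identityˡ M i k = trans (⊗-sum identity M i k) (sum-δˡ i (λ j → M j k))

⊗-identityʳ : ∀ {n} (M : Matrix n) → (M ⊗ identity) ≐ M
⊗-identityʳ M i k = trans (⊗-sum M identity i k) (sum-δʳ k (M i))

diag≡δ* : ∀ {n} (d : Fin n → ℤ) k l → diag d k l ≡ δ k l * d l
diag≡δ* d k l with k FinP.≟ l
... | yes refl = sym (*-identityˡ (d k))
... | no _     = refl

⊗-diag : ∀ {n} (A : Matrix n) (d : Fin n → ℤ) i l → (A ⊗ diag d) i l ≡ A i l * d l
⊗-diag A d i l = begin
  (A ⊗ diag d) i l                    ≡⟨ ⊗-sum A (diag d) i l ⟩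
  sum (λ k → A i k * diag d k l)      ≡⟨ sum-cong-≗ (λ k → cong (A i k *_) (diag≡δ* d k l)) ⟩
  sum (λ k → A i k * (δ k l * d l))   ≡⟨ sum-cong-≗ (λ k → *-assoc (A i k) (δ k l) (d l)) ⟨
  sum (λ k → A i k * δ k l * d l)     ≡⟨ *-distribʳ-sum (d l) (λ k → A i k * δ k l) ⟨
  sum (λ k → A i k * δ k l) * d l     ≡⟨ cong (_* d l) (sum-δʳ l (A i)) ⟩
  A i l * d l                         ∎
  where open ≡-Reasoning

diag-cong : ∀ {n} {d e : Fin n → ℤ} → d ≗ e → diag d ≐ diag e
diag-cong d≗e i j = cong (λ x → if ⌊ i FinP.≟ j ⌋ then x else 0ℤ) (d≗e i)

_≐?_ : ∀ {n} (M N : Matrix n) → Dec (M ≐ N)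
M ≐? N = FinP.all? λ i → FinP.all? λ j → M i j ℤ.≟ N i j

fromRows : ∀ {n} → Vec (Vec ℤ n) n → Matrix n
fromRows rows i j = Vec.lookup (Vec.lookup rows i) j

⊗-cancel-inner : ∀ {n} (A B : Matrix n) {Q Q' : Matrix n} → (Q ⊗ Q') ≐ identity → ((A ⊗ Q) ⊗ (Q' ⊗ B)) ≐ (A ⊗ B)
⊗-cancel-inner A B {Q} {Q'} QQ'≐I = begin
  (A ⊗ Q) ⊗ (Q' ⊗ B) ≈⟨ ⊗-assoc A Q (Q' ⊗ B) ⟩
  A ⊗ (Q ⊗ (Q' ⊗ B)) ≈⟨ ⊗-congˡ A (⊗-assoc Q Q' B) ⟨
  A ⊗ ((Q ⊗ Q') ⊗ B) ≈⟨ ⊗-congˡ A (⊗-congʳ B QQ'≐I) ⟩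
  A ⊗ (identity ⊗ B) ≈⟨ ⊗-congˡ A (⊗-identityˡ B) ⟩
  A ⊗ B              ∎
  where open ≐-Reasoning

unimodular-identity : ∀ {n} → Unimodular {n} identity
unimodular-identity = identity , ⊗-identityˡ identity , ⊗-identityˡ identity

unimodular-⊗ : ∀ {n} {P Q : Matrix n} → Unimodular P → Unimodular Q → Unimodular (P ⊗ Q)
unimodular-⊗ {P = P} {Q} (P' , PP' , P'P) (Q' , QQ' , Q'Q) =
  Q' ⊗ P' , ≐.trans (⊗-cancel-inner P P' QQ') PP' , ≐.trans (⊗-cancel-inner Q' Q P'P) Q'Q

infix 4 _∼_

_∼_ : ∀ {n} → Matrix n → Matrix n → Set
_∼_ {n} M N = Σ (Matrix n) λ P → Σ (Matrix n) λ Q → Unimodular P × Unimodular Q × (((P ⊗ M) ⊗ Q) ≐ N)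

∼-reflexive : ∀ {n} {M N : Matrix n} → M ≐ N → M ∼ N
∼-reflexive {M = M} M≐N =
  identity , identity , unimodular-identity , unimodular-identity ,
  ≐.trans (⊗-identityʳ (identity ⊗ M)) (≐.trans (⊗-identityˡ M) M≐N)

∼-trans : ∀ {n} {M N K : Matrix n} → M ∼ N → N ∼ K → M ∼ K
∼-trans {M = M} {N} {K} (P₁ , Q₁ , uP₁ , uQ₁ , P₁MQ₁≐N) (P₂ , Q₂ , uP₂ , uQ₂ , P₂NQ₂≐K) =
  P₂ ⊗ P₁ , Q₁ ⊗ Q₂ , unimodular-⊗ uP₂ uP₁ , unimodular-⊗ uQ₁ uQ₂ , (begin
    ((P₂ ⊗ P₁) ⊗ M) ⊗ (Q₁ ⊗ Q₂)   ≈⟨ ⊗-congʳ (Q₁ ⊗ Q₂) (⊗-assoc P₂ P₁ M) ⟩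
    (P₂ ⊗ (P₁ ⊗ M)) ⊗ (Q₁ ⊗ Q₂)   ≈⟨ ⊗-assoc P₂ (P₁ ⊗ M) (Q₁ ⊗ Q₂) ⟩
    P₂ ⊗ ((P₁ ⊗ M) ⊗ (Q₁ ⊗ Q₂))   ≈⟨ ⊗-congˡ P₂ (⊗-assoc (P₁ ⊗ M) Q₁ Q₂) ⟨
    P₂ ⊗ (((P₁ ⊗ M) ⊗ Q₁) ⊗ Q₂)   ≈⟨ ⊗-congˡ P₂ (⊗-congʳ Q₂ P₁MQ₁≐N) ⟩
    P₂ ⊗ (N ⊗ Q₂)                 ≈⟨ ⊗-assoc P₂ N Q₂ ⟨
    (P₂ ⊗ N) ⊗ Q₂                 ≈⟨ P₂NQ₂≐K ⟩
    K                             ∎)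
  where open ≐-Reasoning

∼-unfold : ∀ {n} {M N : Matrix n} → M ∼ N → Σ (Matrix n) λ P' → Σ (Matrix n) λ Q' → M ≐ ((P' ⊗ N) ⊗ Q')
∼-unfold {M = M} {N} (P , Q , (P' , _ , P'P) , (Q' , QQ' , _) , PMQ≐N) = P' , Q' , (begin
  M                               ≈⟨ ⊗-identityˡ M ⟨
  identity ⊗ M                    ≈⟨ ⊗-congʳ M P'P ⟨
  (P' ⊗ P) ⊗ M                    ≈⟨ ⊗-identityʳ _ ⟨
  ((P' ⊗ P) ⊗ M) ⊗ identity       ≈⟨ ⊗-congˡ ((P' ⊗ P) ⊗ M) QQ' ⟨
  ((P' ⊗ P) ⊗ M) ⊗ (Q ⊗ Q')       ≈⟨ ⊗-congʳ (Q ⊗ Q') (⊗-assoc P' P M) ⟩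
  (P' ⊗ (P ⊗ M)) ⊗ (Q ⊗ Q')       ≈⟨ ⊗-assoc (P' ⊗ (P ⊗ M)) Q Q' ⟨
  ((P' ⊗ (P ⊗ M)) ⊗ Q) ⊗ Q'       ≈⟨ ⊗-congʳ Q' (⊗-assoc P' (P ⊗ M) Q) ⟩
  (P' ⊗ ((P ⊗ M) ⊗ Q)) ⊗ Q'       ≈⟨ ⊗-congʳ Q' (⊗-congˡ P' PMQ≐N) ⟩
  (P' ⊗ N) ⊗ Q'                   ∎)
  where open ≐-Reasoning

isSmithNormalForm-∼ : ∀ {n} {M N : Matrix n} {d} → M ∼ N → IsSmithNormalForm N d → IsSmithNormalForm M d
isSmithNormalForm-∼ M∼N (d≥0 , d-chain , N∼diag-d) = d≥0 , d-chain , ∼-trans M∼N N∼diag-d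

transpose-matchˡ : ∀ {n} (i j : Fin n) → PC.transpose i j i ≡ j
transpose-matchˡ i j rewrite dec-true (i FinP.≟ i) refl = refl

transpose-fixes : ∀ {n} {i j k : Fin n} → k ≢ i → k ≢ j → PC.transpose i j k ≡ k
transpose-fixes {i = i} {j} {k} k≢i k≢j rewrite dec-false (k FinP.≟ i) k≢i | dec-false (k FinP.≟ j) k≢j = refl

extendToPermutation : ∀ {k n} (ι e : Fin k → Fin n) → Injective _≡_ _≡_ ι → Injective _≡_ _≡_ e →
  Σ (Permutation′ n) λ π → ∀ c → π ⟨$⟩ʳ ι c ≡ e c
extendToPermutation {zero}  ι e _ _ = Perm.id , λ ()
extendToPermutation {suc k} {n} ι e ι-inj e-inj = Perm.transpose (ι fz) t ∘ₚ π , extends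
  where
  rest : Σ (Permutation′ n) λ π → ∀ c → π ⟨$⟩ʳ ι (fs c) ≡ e (fs c)
  rest = extendToPermutation (ι ∘ fs) (e ∘ fs)
           (λ eq → FinP.suc-injective (ι-inj eq)) (λ eq → FinP.suc-injective (e-inj eq))
  π : Permutation′ n
  π = proj₁ rest
  t : Fin n
  t = π ⟨$⟩ˡ e fz
  extends : ∀ c → π ⟨$⟩ʳ PC.transpose (ι fz) t (ι c) ≡ e c
  extends fz     = trans (cong (π ⟨$⟩ʳ_) (transpose-matchˡ (ι fz) t)) (Perm.inverseʳ π)
  extends (fs c) = trans (cong (π ⟨$⟩ʳ_) (transpose-fixes ι[1+c]≢ι[0] ι[1+c]≢t)) (proj₂ rest c)
    where
    ι[1+c]≢ι[0] : ι (fs c) ≢ ι fz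
    ι[1+c]≢ι[0] eq with () ← ι-inj eq
    ι[1+c]≢t : ι (fs c) ≢ t
    ι[1+c]≢t eq with () ← e-inj (trans (sym (proj₂ rest c)) (trans (cong (π ⟨$⟩ʳ_) eq) (Perm.inverseʳ π)))

module _ {n : ℕ} where

  permutationMatrix permutationMatrixᵀ : Permutation′ n → Matrix n
  permutationMatrix  π i k = δ (π ⟨$⟩ʳ i) k
  permutationMatrixᵀ π k j = δ k (π ⟨$⟩ʳ j)

  permutationMatrix-⊗ : ∀ π (M : Matrix n) → (permutationMatrix π ⊗ M) ≐ (λ i j → M (π ⟨$⟩ʳ i) j)
  permutationMatrix-⊗ π M i j = trans (⊗-sum (permutationMatrix π) M i j) (sum-δˡ (π ⟨$⟩ʳ i) (λ k → M k j))

  ⊗-permutationMatrixᵀ : ∀ π (M : Matrix n) → (M ⊗ permutationMatrixᵀ π) ≐ (λ i j → M i (π ⟨$⟩ʳ j))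
  ⊗-permutationMatrixᵀ π M i j = trans (⊗-sum M (permutationMatrixᵀ π) i j) (sum-δʳ (π ⟨$⟩ʳ j) (M i))

  ∼-permute : ∀ (π : Permutation′ n) (M : Matrix n) → M ∼ (λ i j → M (π ⟨$⟩ʳ i) (π ⟨$⟩ʳ j))
  ∼-permute π M = P π , Pᵀ π , unimodular-P , unimodular-Pᵀ , λ i j →
    trans (⊗-permutationMatrixᵀ π (P π ⊗ M) i j) (permutationMatrix-⊗ π M i (π ⟨$⟩ʳ j))
    where
    P Pᵀ : Permutation′ n → Matrix n
    P  = permutationMatrix
    Pᵀ = permutationMatrixᵀ
    π⁻¹ : Permutation′ n
    π⁻¹ = Perm.flip π
    unimodular-P : Unimodular (P π)
    unimodular-P = P π⁻¹ ,
      (λ i j → trans (permutationMatrix-⊗ π (P π⁻¹) i j) (cong (λ k → δ k j) (Perm.inverseˡ π))) ,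
      (λ i j → trans (permutationMatrix-⊗ π⁻¹ (P π) i j) (cong (λ k → δ k j) (Perm.inverseʳ π)))
    unimodular-Pᵀ : Unimodular (Pᵀ π)
    unimodular-Pᵀ = Pᵀ π⁻¹ ,
      (λ i j → trans (⊗-permutationMatrixᵀ π⁻¹ (Pᵀ π) i j) (cong (δ i) (Perm.inverseʳ π))) ,
      (λ i j → trans (⊗-permutationMatrixᵀ π (Pᵀ π⁻¹) i j) (cong (δ i) (Perm.inverseˡ π)))

module Shear {n : ℕ} (ρ : Fin n → Fin n) where

  shear shearᵀ : (Fin n → ℤ) → Matrix n
  shear  c x z = δ x z + c x * δ (ρ x) z
  shearᵀ c z y = δ z y + c y * δ z (ρ y)

  shear-⊗ : ∀ c (M : Matrix n) → (shear c ⊗ M) ≐ (λ x y → M x y + c x * M (ρ x) y)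
  shear-⊗ c M x y = trans (⊗-sum (shear c) M x y) (sum-rowOperation x (ρ x) (c x) (λ z → M z y))

  ⊗-shearᵀ : ∀ c (M : Matrix n) → (M ⊗ shearᵀ c) ≐ (λ x y → M x y + c y * M x (ρ y))
  ⊗-shearᵀ c M x y = trans (⊗-sum M (shearᵀ c) x y) (sum-columnOperation y (ρ y) (c y) (M x))

  private
    cancelˡ : ∀ d e f a b → b ≡ 0ℤ → (d + (- a) * e) + a * (e + b * f) ≡ d
    cancelˡ d e f a _ refl = ring d e f a
      where ring : ∀ d e f a → (d + (- a) * e) + a * (e + 0ℤ * f) ≡ d
            ring = solve-∀
    cancelʳ : ∀ d e f a b → b ≡ 0ℤ → (d + a * e) + (- a) * (e + b * f) ≡ d
    cancelʳ d e f a _ refl = ring d e f a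
      where ring : ∀ d e f a → (d + a * e) + (- a) * (e + 0ℤ * f) ≡ d
            ring = solve-∀

  unimodular-shear : ∀ c → (∀ x → c (ρ x) ≡ 0ℤ) → Unimodular (shear c)
  unimodular-shear c c∘ρ≡0 = shear (-_ ∘ c) ,
    (λ x w → trans (shear-⊗ c (shear (-_ ∘ c)) x w)
                   (cancelˡ (δ x w) (δ (ρ x) w) (δ (ρ (ρ x)) w) (c x) _ (cong -_ (c∘ρ≡0 x)))) ,
    (λ x w → trans (shear-⊗ (-_ ∘ c) (shear c) x w)
                   (cancelʳ (δ x w) (δ (ρ x) w) (δ (ρ (ρ x)) w) (c x) _ (c∘ρ≡0 x)))

  unimodular-shearᵀ : ∀ c → (∀ x → c (ρ x) ≡ 0ℤ) → Unimodular (shearᵀ c)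
  unimodular-shearᵀ c c∘ρ≡0 = shearᵀ (-_ ∘ c) ,
    (λ z y → trans (⊗-shearᵀ (-_ ∘ c) (shearᵀ c) z y)
                   (cancelʳ (δ z y) (δ z (ρ y)) (δ z (ρ (ρ y))) (c y) _ (c∘ρ≡0 y))) ,
    (λ z y → trans (⊗-shearᵀ c (shearᵀ (-_ ∘ c)) z y)
                   (cancelˡ (δ z y) (δ z (ρ y)) (δ z (ρ (ρ y))) (c y) _ (cong -_ (c∘ρ≡0 y))))

  kept : Fin n → ℤ
  kept x = indicator ⌊ x FinP.≟ ρ x ⌋

  -- Each row x outside the image of ρ becomes row x minus row ρ x, which vanishes; likewise for columns.
  ∼-collapse : ∀ (M : Matrix n) → (∀ x → ρ (ρ x) ≡ ρ x) →
    (∀ x y → M (ρ x) y ≡ M x y) → (∀ x y → M x (ρ y) ≡ M x y) →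
    M ∼ (λ x y → kept x * kept y * M x y)
  ∼-collapse M ρ-idem rowTwin colTwin =
    shear c , shearᵀ c , unimodular-shear c c∘ρ≡0 , unimodular-shearᵀ c c∘ρ≡0 , λ x y → begin
      ((shear c ⊗ M) ⊗ shearᵀ c) x y
        ≡⟨ ⊗-shearᵀ c (shear c ⊗ M) x y ⟩
      (shear c ⊗ M) x y + c y * (shear c ⊗ M) x (ρ y)
        ≡⟨ cong₂ (λ s t → s + c y * t) (shear-⊗ c M x y) (shear-⊗ c M x (ρ y)) ⟩
      (M x y + c x * M (ρ x) y) + c y * (M x (ρ y) + c x * M (ρ x) (ρ y))
        ≡⟨ cong₂ (λ s t → (M x y + c x * s) + c y * (M x (ρ y) + c x * t))
                 (rowTwin x y) (trans (rowTwin x (ρ y)) (colTwin x y)) ⟩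
      (M x y + c x * M x y) + c y * (M x (ρ y) + c x * M x y)
        ≡⟨ cong (λ s → (M x y + c x * M x y) + c y * (s + c x * M x y)) (colTwin x y) ⟩
      (M x y + c x * M x y) + c y * (M x y + c x * M x y)
        ≡⟨ factor (M x y) (kept x) (kept y) ⟩
      kept x * kept y * M x y ∎
    where
    open ≡-Reasoning
    c : Fin n → ℤ
    c x = kept x - 1ℤ
    c∘ρ≡0 : ∀ x → c (ρ x) ≡ 0ℤ
    c∘ρ≡0 x with ρ x FinP.≟ ρ (ρ x)
    ... | yes _    = refl
    ... | no ρx≢ρx = ⊥-elim (ρx≢ρx (sym (ρ-idem x)))
    factor : ∀ m a b → (m + (a - 1ℤ) * m) + (b - 1ℤ) * (m + (a - 1ℤ) * m) ≡ a * b * m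
    factor = solve-∀

data BlockIndex (k m : ℕ) : Fin (k ℕ.+ m) → Set where
  upper : ∀ a → BlockIndex k m (a ↑ˡ m)
  lower : ∀ b → BlockIndex k m (k ↑ʳ b)

blockIndex : ∀ k {m} (i : Fin (k ℕ.+ m)) → BlockIndex k m i
blockIndex k i with splitAt k i in eq
... | inj₁ a = subst (BlockIndex k _) (FinP.splitAt⁻¹-↑ˡ eq) (upper a)
... | inj₂ b = subst (BlockIndex k _) (FinP.splitAt⁻¹-↑ʳ eq) (lower b)

module _ {k m : ℕ} (X : Matrix k) (Y : Matrix m) where

  private
    upperRows : Fin k → Fin (k ℕ.+ m) → ℤ
    upperRows a = X a ++ λ _ → 0ℤ
    lowerRows : Fin m → Fin (k ℕ.+ m) → ℤ
    lowerRows b = (λ _ → 0ℤ) ++ Y b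

  blockDiag : Matrix (k ℕ.+ m)
  blockDiag = upperRows ++ lowerRows

  blockDiag-uu : ∀ a c → blockDiag (a ↑ˡ m) (c ↑ˡ m) ≡ X a c
  blockDiag-uu a c = trans (cong-app (lookup-++ˡ upperRows lowerRows a) (c ↑ˡ m)) (lookup-++ˡ (X a) (λ _ → 0ℤ) c)

  blockDiag-ul : ∀ a d → blockDiag (a ↑ˡ m) (k ↑ʳ d) ≡ 0ℤ
  blockDiag-ul a d = trans (cong-app (lookup-++ˡ upperRows lowerRows a) (k ↑ʳ d)) (lookup-++ʳ (X a) (λ _ → 0ℤ) d)

  blockDiag-lu : ∀ b c → blockDiag (k ↑ʳ b) (c ↑ˡ m) ≡ 0ℤ
  blockDiag-lu b c = trans (cong-app (lookup-++ʳ upperRows lowerRows b) (c ↑ˡ m)) (lookup-++ˡ (λ (_ : Fin k) → 0ℤ) (Y b) c)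

  blockDiag-ll : ∀ b d → blockDiag (k ↑ʳ b) (k ↑ʳ d) ≡ Y b d
  blockDiag-ll b d = trans (cong-app (lookup-++ʳ upperRows lowerRows b) (k ↑ʳ d)) (lookup-++ʳ (λ (_ : Fin k) → 0ℤ) (Y b) d)

blockDiag-⊗ : ∀ {k m} (X X' : Matrix k) (Y Y' : Matrix m) →
  (blockDiag X Y ⊗ blockDiag X' Y') ≐ blockDiag (X ⊗ X') (Y ⊗ Y')
blockDiag-⊗ {k} {m} X X' Y Y' i j =
  trans (⊗-sum B B' i j) (trans (sum-↑ k (λ l → B i l * B' l j)) (entry (blockIndex k i) (blockIndex k j)))
  where
  B B' : Matrix (k ℕ.+ m)
  B  = blockDiag X Y
  B' = blockDiag X' Y'
  upperPart lowerPart : Fin (k ℕ.+ m) → Fin (k ℕ.+ m) → ℤ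
  upperPart i j = sum (λ c → B i (c ↑ˡ m) * B' (c ↑ˡ m) j)
  lowerPart i j = sum (λ d → B i (k ↑ʳ d) * B' (k ↑ʳ d) j)
  entry : ∀ {i j} → BlockIndex k m i → BlockIndex k m j → upperPart i j + lowerPart i j ≡ blockDiag (X ⊗ X') (Y ⊗ Y') i j
  entry (upper a) (upper c) = begin
    upperPart (a ↑ˡ m) (c ↑ˡ m) + lowerPart (a ↑ˡ m) (c ↑ˡ m)
      ≡⟨ cong₂ _+_ (sum-cong-≗ λ e → cong₂ _*_ (blockDiag-uu X Y a e) (blockDiag-uu X' Y' e c))
                   (sum-zero λ e → *-annihilateˡ (B' (k ↑ʳ e) _) (blockDiag-ul X Y a e)) ⟩
    sum (λ e → X a e * X' e c) + 0ℤ      ≡⟨ +-identityʳ _ ⟩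
    sum (λ e → X a e * X' e c)           ≡⟨ ⊗-sum X X' a c ⟨
    (X ⊗ X') a c                         ≡⟨ blockDiag-uu (X ⊗ X') (Y ⊗ Y') a c ⟨
    blockDiag (X ⊗ X') (Y ⊗ Y') (a ↑ˡ m) (c ↑ˡ m) ∎
    where open ≡-Reasoning
  entry (upper a) (lower d) = begin
    upperPart (a ↑ˡ m) (k ↑ʳ d) + lowerPart (a ↑ˡ m) (k ↑ʳ d)
      ≡⟨ cong₂ _+_ (sum-zero λ e → *-annihilateʳ (B (a ↑ˡ m) (e ↑ˡ m)) (blockDiag-ul X' Y' e d))
                   (sum-zero λ e → *-annihilateˡ (B' (k ↑ʳ e) _) (blockDiag-ul X Y a e)) ⟩
    0ℤ                                   ≡⟨ blockDiag-ul (X ⊗ X') (Y ⊗ Y') a d ⟨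
    blockDiag (X ⊗ X') (Y ⊗ Y') (a ↑ˡ m) (k ↑ʳ d) ∎
    where open ≡-Reasoning
  entry (lower b) (upper c) = begin
    upperPart (k ↑ʳ b) (c ↑ˡ m) + lowerPart (k ↑ʳ b) (c ↑ˡ m)
      ≡⟨ cong₂ _+_ (sum-zero λ e → *-annihilateˡ (B' (e ↑ˡ m) _) (blockDiag-lu X Y b e))
                   (sum-zero λ e → *-annihilateʳ (B (k ↑ʳ b) (k ↑ʳ e)) (blockDiag-lu X' Y' e c)) ⟩
    0ℤ                                   ≡⟨ blockDiag-lu (X ⊗ X') (Y ⊗ Y') b c ⟨
    blockDiag (X ⊗ X') (Y ⊗ Y') (k ↑ʳ b) (c ↑ˡ m) ∎
    where open ≡-Reasoning
  entry (lower b) (lower d) = begin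
    upperPart (k ↑ʳ b) (k ↑ʳ d) + lowerPart (k ↑ʳ b) (k ↑ʳ d)
      ≡⟨ cong₂ _+_ (sum-zero λ e → *-annihilateˡ (B' (e ↑ˡ m) _) (blockDiag-lu X Y b e))
                   (sum-cong-≗ λ e → cong₂ _*_ (blockDiag-ll X Y b e) (blockDiag-ll X' Y' e d)) ⟩
    0ℤ + sum (λ e → Y b e * Y' e d)      ≡⟨ +-identityˡ _ ⟩
    sum (λ e → Y b e * Y' e d)           ≡⟨ ⊗-sum Y Y' b d ⟨
    (Y ⊗ Y') b d                         ≡⟨ blockDiag-ll (X ⊗ X') (Y ⊗ Y') b d ⟨
    blockDiag (X ⊗ X') (Y ⊗ Y') (k ↑ʳ b) (k ↑ʳ d) ∎
    where open ≡-Reasoning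

module _ {k m : ℕ} where

  blockDiag-cong : ∀ {X X' : Matrix k} {Y Y' : Matrix m} → X ≐ X' → Y ≐ Y' → blockDiag X Y ≐ blockDiag X' Y'
  blockDiag-cong {X} {X'} {Y} {Y'} X≐X' Y≐Y' i j = entry (blockIndex k i) (blockIndex k j)
    where
    entry : ∀ {i j} → BlockIndex k m i → BlockIndex k m j → blockDiag X Y i j ≡ blockDiag X' Y' i j
    entry (upper a) (upper c) = trans (blockDiag-uu X Y a c) (trans (X≐X' a c) (sym (blockDiag-uu X' Y' a c)))
    entry (upper a) (lower d) = trans (blockDiag-ul X Y a d) (sym (blockDiag-ul X' Y' a d))
    entry (lower b) (upper c) = trans (blockDiag-lu X Y b c) (sym (blockDiag-lu X' Y' b c))
    entry (lower b) (lower d) = trans (blockDiag-ll X Y b d) (trans (Y≐Y' b d) (sym (blockDiag-ll X' Y' b d)))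

  diag-++ : ∀ (d : Fin k → ℤ) (e : Fin m → ℤ) → diag (d ++ e) ≐ blockDiag (diag d) (diag e)
  diag-++ d e i j = entry (blockIndex k i) (blockIndex k j)
    where
    entry : ∀ {i j} → BlockIndex k m i → BlockIndex k m j → diag (d ++ e) i j ≡ blockDiag (diag d) (diag e) i j
    entry (upper a) (upper c) =
      trans (cong₂ (λ b x → if b then x else 0ℤ) (⌊≟⌋-injective (FinP.↑ˡ-injective m _ _) a c) (lookup-++ˡ d e a))
            (sym (blockDiag-uu (diag d) (diag e) a c))
    entry (upper a) (lower c) =
      trans (cong (λ b → if b then _ else 0ℤ) (⌊≟⌋-distinct (↑ˡ≢↑ʳ a c))) (sym (blockDiag-ul (diag d) (diag e) a c))
    entry (lower b) (upper c) =
      trans (cong (λ b → if b then _ else 0ℤ) (⌊≟⌋-distinct (↑ˡ≢↑ʳ c b ∘ sym))) (sym (blockDiag-lu (diag d) (diag e) b c))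
    entry (lower b) (lower c) =
      trans (cong₂ (λ b x → if b then x else 0ℤ) (⌊≟⌋-injective (FinP.↑ʳ-injective k _ _) b c) (lookup-++ʳ d e b))
            (sym (blockDiag-ll (diag d) (diag e) b c))

  identity≐blockDiag : identity ≐ blockDiag {k} {m} identity identity
  identity≐blockDiag = ≐.trans (diag-cong ones) (diag-++ (λ _ → 1ℤ) (λ _ → 1ℤ))
    where
    ones : ∀ i → 1ℤ ≡ ((λ (_ : Fin k) → 1ℤ) ++ (λ (_ : Fin m) → 1ℤ)) i
    ones i with splitAt k i
    ... | inj₁ _ = refl
    ... | inj₂ _ = refl

  unimodular-blockDiag : ∀ {X : Matrix k} {Y : Matrix m} → Unimodular X → Unimodular Y → Unimodular (blockDiag X Y)
  unimodular-blockDiag {X} {Y} (X' , XX' , X'X) (Y' , YY' , Y'Y) =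
    blockDiag X' Y' , inverse X X' Y Y' XX' YY' , inverse X' X Y' Y X'X Y'Y
    where
    inverse : ∀ A A' B B' → (A ⊗ A') ≐ identity → (B ⊗ B') ≐ identity → (blockDiag A B ⊗ blockDiag A' B') ≐ identity
    inverse A A' B B' AA' BB' = begin
      blockDiag A B ⊗ blockDiag A' B'     ≈⟨ blockDiag-⊗ A A' B B' ⟩
      blockDiag (A ⊗ A') (B ⊗ B')         ≈⟨ blockDiag-cong AA' BB' ⟩
      blockDiag {k} {m} identity identity ≈⟨ identity≐blockDiag ⟨
      identity                            ∎
      where open ≐-Reasoning

  ∼-blockDiag : ∀ {X X' : Matrix k} {Y Y' : Matrix m} → X ∼ X' → Y ∼ Y' → blockDiag X Y ∼ blockDiag X' Y'
  ∼-blockDiag {X} {X'} {Y} {Y'} (P₁ , Q₁ , uP₁ , uQ₁ , P₁XQ₁≐X') (P₂ , Q₂ , uP₂ , uQ₂ , P₂YQ₂≐Y') =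
    blockDiag P₁ P₂ , blockDiag Q₁ Q₂ , unimodular-blockDiag uP₁ uP₂ , unimodular-blockDiag uQ₁ uQ₂ , (begin
      (blockDiag P₁ P₂ ⊗ blockDiag X Y) ⊗ blockDiag Q₁ Q₂  ≈⟨ ⊗-congʳ (blockDiag Q₁ Q₂) (blockDiag-⊗ P₁ X P₂ Y) ⟩
      blockDiag (P₁ ⊗ X) (P₂ ⊗ Y) ⊗ blockDiag Q₁ Q₂       ≈⟨ blockDiag-⊗ (P₁ ⊗ X) Q₁ (P₂ ⊗ Y) Q₂ ⟩
      blockDiag ((P₁ ⊗ X) ⊗ Q₁) ((P₂ ⊗ Y) ⊗ Q₂)           ≈⟨ blockDiag-cong P₁XQ₁≐X' P₂YQ₂≐Y' ⟩
      blockDiag X' Y'                                     ∎)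
    where open ≐-Reasoning

-- Smith normal forms of complete multipartite graphs

countFin-cong : ∀ {n} {p q : Fin n → Bool} → p ≗ q → countFin p ≡ countFin q
countFin-cong {zero}  p≗q = refl
countFin-cong {suc n} p≗q = cong₂ (λ b c → (if b then 1 else 0) ℕ.+ c) (p≗q fz) (countFin-cong (p≗q ∘ fs))

countFin-↑ : ∀ k {m} (p : Fin (k ℕ.+ m) → Bool) →
  countFin p ≡ countFin (λ a → p (a ↑ˡ m)) ℕ.+ countFin (λ b → p (k ↑ʳ b))
countFin-↑ zero    p = refl
countFin-↑ (suc k) p =
  trans (cong ((if p fz then 1 else 0) ℕ.+_) (countFin-↑ k (p ∘ fs))) (sym (ℕ.+-assoc (if p fz then 1 else 0) _ _))

countFin-false : ∀ n → countFin {n} (λ _ → false) ≡ 0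
countFin-false zero    = refl
countFin-false (suc n) = countFin-false n

threeUnits⇒3≤numUnitInvariantFactors : ∀ {n} (d : Fin (3 ℕ.+ n) → ℤ) → d 0F ≡ 1ℤ → d 1F ≡ 1ℤ → d 2F ≡ 1ℤ →
  3 ≤ numUnitInvariantFactors d
threeUnits⇒3≤numUnitInvariantFactors d d₀≡1 d₁≡1 d₂≡1 rewrite d₀≡1 | d₁≡1 | d₂≡1 = s≤s (s≤s (s≤s z≤n))

DivisibilityChain : ∀ {n} → (Fin n → ℤ) → Set
DivisibilityChain {n} d = ∀ (i j : Fin n) → toℕ i ≤ toℕ j → d i ∣ d j

nonnegative? : ∀ {n} (d : Fin n → ℤ) → Dec (∀ i → 0ℤ ℤ.≤ d i)
nonnegative? d = FinP.all? λ i → 0ℤ ℤ.≤? d i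

divisibilityChain? : ∀ {n} (d : Fin n → ℤ) → Dec (DivisibilityChain d)
divisibilityChain? d = FinP.all? λ i → FinP.all? λ j → (toℕ i ℕ.≤? toℕ j) →-dec (∣ d i ∣ ℕD.∣? ∣ d j ∣)

padded : ∀ {k m} → (Fin k → ℤ) → Fin (k ℕ.+ m) → ℤ
padded {m = m} d = d ++ λ (_ : Fin m) → 0ℤ

module _ {k m : ℕ} (d : Fin k → ℤ) where

  numUnitInvariantFactors-padded : numUnitInvariantFactors (padded {m = m} d) ≡ numUnitInvariantFactors d
  numUnitInvariantFactors-padded = begin
    numUnitInvariantFactors (padded {m = m} d)
      ≡⟨ countFin-↑ k {m} (λ i → ⌊ padded d i ℤ.≟ 1ℤ ⌋) ⟩
    countFin (λ a → ⌊ padded {m = m} d (a ↑ˡ m) ℤ.≟ 1ℤ ⌋) ℕ.+ countFin (λ b → ⌊ padded {m = m} d (k ↑ʳ b) ℤ.≟ 1ℤ ⌋)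
      ≡⟨ cong₂ ℕ._+_ (countFin-cong λ a → cong (λ x → ⌊ x ℤ.≟ 1ℤ ⌋) (lookup-++ˡ d (λ (_ : Fin m) → 0ℤ) a))
                     (trans (countFin-cong {q = λ _ → false} λ b →
                               cong (λ x → ⌊ x ℤ.≟ 1ℤ ⌋) (lookup-++ʳ d (λ (_ : Fin m) → 0ℤ) b))
                            (countFin-false m)) ⟩
    numUnitInvariantFactors d ℕ.+ 0
      ≡⟨ ℕ.+-identityʳ (numUnitInvariantFactors d) ⟩
    numUnitInvariantFactors d ∎
    where open ≡-Reasoning

  isSmithNormalForm-padded : ∀ {X : Matrix k} → IsSmithNormalForm X d →
    IsSmithNormalForm (blockDiag X (λ (_ _ : Fin m) → 0ℤ)) (padded d)
  isSmithNormalForm-padded (d≥0 , d-chain , X∼diag-d) =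
    nonnegative , chain ,
    ∼-trans (∼-blockDiag X∼diag-d (∼-reflexive zero≐diag)) (∼-reflexive (≐.sym (diag-++ d (λ _ → 0ℤ))))
    where
    zero≐diag : (λ _ _ → 0ℤ) ≐ diag {m} (λ _ → 0ℤ)
    zero≐diag i j with ⌊ i FinP.≟ j ⌋
    ... | true  = refl
    ... | false = refl
    nonnegative : ∀ i → 0ℤ ℤ.≤ padded d i
    nonnegative i with blockIndex k i
    ... | upper a = subst (0ℤ ℤ.≤_) (sym (lookup-++ˡ d (λ (_ : Fin m) → 0ℤ) a)) (d≥0 a)
    ... | lower b = subst (0ℤ ℤ.≤_) (sym (lookup-++ʳ d (λ (_ : Fin m) → 0ℤ) b)) ℤ.≤-refl
    chain : DivisibilityChain (padded d)
    chain i j i≤j with blockIndex k i | blockIndex k j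
    ... | _       | lower b = subst (padded d i ∣_) (sym (lookup-++ʳ d (λ (_ : Fin m) → 0ℤ) b)) (ℕD._∣0 _)
    ... | upper a | upper c =
      subst₂ _∣_ (sym (lookup-++ˡ d (λ (_ : Fin m) → 0ℤ) a)) (sym (lookup-++ˡ d (λ (_ : Fin m) → 0ℤ) c))
        (d-chain a c (subst₂ _≤_ (FinP.toℕ-↑ˡ a m) (FinP.toℕ-↑ˡ c m) i≤j))
    ... | lower b | upper c = ⊥-elim (ℕ.<⇒≱ (FinP.toℕ<n c) (begin
      k                    ≤⟨ ℕ.m≤m+n k (toℕ b) ⟩
      k ℕ.+ toℕ b          ≡⟨ FinP.toℕ-↑ʳ k b ⟨
      toℕ (k ↑ʳ b)         ≤⟨ i≤j ⟩
      toℕ (c ↑ˡ m)         ≡⟨ FinP.toℕ-↑ˡ c m ⟩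
      toℕ c                ∎))
      where open ℕ.≤-Reasoning

completeGraphMatrix : ∀ k → Matrix k
completeGraphMatrix k i j = indicator (completeGraph k i j)

smithNormalForm-completeGraph : ∀ k → k ≤ 3 →
  Σ (Fin k → ℤ) λ d → IsSmithNormalForm (completeGraphMatrix k) d × numUnitInvariantFactors d ≤ 2
smithNormalForm-completeGraph 0 _ = (λ ()) , ((λ ()) , (λ ()) , ∼-reflexive {M = completeGraphMatrix 0} (λ ())) , z≤n
smithNormalForm-completeGraph 1 _ = d , (from-yes (nonnegative? d) , from-yes (divisibilityChain? d) ,
  ∼-reflexive (from-yes (completeGraphMatrix 1 ≐? diag d))) , z≤n
  where
  d : Fin 1 → ℤ
  d _ = 0ℤ
smithNormalForm-completeGraph 2 _ = d , (from-yes (nonnegative? d) , from-yes (divisibilityChain? d) ,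
  J , identity , (J , from-yes ((J ⊗ J) ≐? identity) , from-yes ((J ⊗ J) ≐? identity)) , unimodular-identity ,
  from-yes (((J ⊗ J) ⊗ identity) ≐? diag d)) , s≤s (s≤s z≤n)
  where
  d : Fin 2 → ℤ
  d _ = 1ℤ
  J : Matrix 2
  J = completeGraphMatrix 2
smithNormalForm-completeGraph 3 _ = d , (from-yes (nonnegative? d) , from-yes (divisibilityChain? d) ,
  U , V , (U , from-yes ((U ⊗ U) ≐? identity) , from-yes ((U ⊗ U) ≐? identity)) ,
  (V⁻¹ , from-yes ((V ⊗ V⁻¹) ≐? identity) , from-yes ((V⁻¹ ⊗ V) ≐? identity)) ,
  from-yes (((U ⊗ completeGraphMatrix 3) ⊗ V) ≐? diag d)) , s≤s (s≤s z≤n)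
  where
  d : Fin 3 → ℤ
  d = Vec.lookup (1ℤ ∷ 1ℤ ∷ + 2 ∷ [])
  U V V⁻¹ : Matrix 3
  U   = fromRows ((0ℤ ∷ 1ℤ ∷ 0ℤ ∷ []) ∷ (1ℤ ∷ 0ℤ ∷ 0ℤ ∷ []) ∷ (1ℤ ∷ 1ℤ ∷ -1ℤ ∷ []) ∷ [])
  V   = fromRows ((1ℤ ∷ 0ℤ ∷ -1ℤ ∷ []) ∷ (0ℤ ∷ 1ℤ ∷ -1ℤ ∷ []) ∷ (0ℤ ∷ 0ℤ ∷ 1ℤ ∷ []) ∷ [])
  V⁻¹ = fromRows ((1ℤ ∷ 0ℤ ∷ 1ℤ ∷ []) ∷ (0ℤ ∷ 1ℤ ∷ 1ℤ ∷ []) ∷ (0ℤ ∷ 0ℤ ∷ 1ℤ ∷ []) ∷ [])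
smithNormalForm-completeGraph (suc (suc (suc (suc _)))) (s≤s (s≤s (s≤s ())))

-- Unlike InducedInCompleteMultipartite below, all k parts are nonempty.
record CompleteMultipartite {n} (G : Graph n) (k : ℕ) : Set where
  field
    part           : Fin n → Fin k
    representative : Fin k → Fin n
    adj≡K          : ∀ x y → adj G x y ≡ completeGraph k (part x) (part y)
    part∘rep       : ∀ c → part (representative c) ≡ c

  representative-injective : Injective _≡_ _≡_ representative
  representative-injective {a} {c} eq = trans (sym (part∘rep a)) (trans (cong part eq) (part∘rep c))

module CompleteMultipartiteReduction {k m : ℕ} {G : Graph (k ℕ.+ m)} (multipartite : CompleteMultipartite G k) where

  open CompleteMultipartite multipartite

  private
    extension : Σ (Permutation′ (k ℕ.+ m)) λ π → ∀ c → π ⟨$⟩ʳ (c ↑ˡ m) ≡ representative c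
    extension = extendToPermutation (_↑ˡ m) representative (FinP.↑ˡ-injective m _ _) representative-injective
    π : Permutation′ (k ℕ.+ m)
    π = proj₁ extension

    part′ : Fin (k ℕ.+ m) → Fin k
    part′ x = part (π ⟨$⟩ʳ x)

    part′-↑ˡ : ∀ a → part′ (a ↑ˡ m) ≡ a
    part′-↑ˡ a = trans (cong part (proj₂ extension a)) (part∘rep a)

    J : Matrix k
    J = completeGraphMatrix k

    M′ : Matrix (k ℕ.+ m)
    M′ x y = adjMatrix G (π ⟨$⟩ʳ x) (π ⟨$⟩ʳ y)

    M′≡J : ∀ x y → M′ x y ≡ J (part′ x) (part′ y)
    M′≡J x y = cong indicator (adj≡K (π ⟨$⟩ʳ x) (π ⟨$⟩ʳ y))

    ρ : Fin (k ℕ.+ m) → Fin (k ℕ.+ m)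
    ρ x = part′ x ↑ˡ m

    part′∘ρ : ∀ x → part′ (ρ x) ≡ part′ x
    part′∘ρ x = part′-↑ˡ (part′ x)

    open Shear ρ using (kept; ∼-collapse)

    kept-↑ˡ : ∀ a → kept (a ↑ˡ m) ≡ 1ℤ
    kept-↑ˡ a with a ↑ˡ m FinP.≟ ρ (a ↑ˡ m)
    ... | yes _   = refl
    ... | no a≢ρa = ⊥-elim (a≢ρa (cong (_↑ˡ m) (sym (part′-↑ˡ a))))

    kept-↑ʳ : ∀ b → kept (k ↑ʳ b) ≡ 0ℤ
    kept-↑ʳ b = cong indicator (⌊≟⌋-distinct (↑ˡ≢↑ʳ (part′ (k ↑ʳ b)) b ∘ sym))

    collapsed≐blockDiag : (λ x y → kept x * kept y * M′ x y) ≐ blockDiag J (λ _ _ → 0ℤ)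
    collapsed≐blockDiag x y = entry (blockIndex k x) (blockIndex k y)
      where
      entry : ∀ {x y} → BlockIndex k m x → BlockIndex k m y → kept x * kept y * M′ x y ≡ blockDiag J (λ _ _ → 0ℤ) x y
      entry (upper a) (upper c) = begin
        kept (a ↑ˡ m) * kept (c ↑ˡ m) * M′ (a ↑ˡ m) (c ↑ˡ m)
          ≡⟨ cong₂ (λ s t → s * t * M′ (a ↑ˡ m) (c ↑ˡ m)) (kept-↑ˡ a) (kept-↑ˡ c) ⟩
        1ℤ * M′ (a ↑ˡ m) (c ↑ˡ m)                   ≡⟨ *-identityˡ _ ⟩
        M′ (a ↑ˡ m) (c ↑ˡ m)                        ≡⟨ M′≡J (a ↑ˡ m) (c ↑ˡ m) ⟩
        J (part′ (a ↑ˡ m)) (part′ (c ↑ˡ m))         ≡⟨ cong₂ J (part′-↑ˡ a) (part′-↑ˡ c) ⟩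
        J a c                                       ≡⟨ blockDiag-uu J _ a c ⟨
        blockDiag J (λ _ _ → 0ℤ) (a ↑ˡ m) (c ↑ˡ m)  ∎
        where open ≡-Reasoning
      entry (upper a) (lower d) =
        trans (*-annihilateˡ (M′ (a ↑ˡ m) (k ↑ʳ d)) (*-annihilateʳ (kept (a ↑ˡ m)) (kept-↑ʳ d))) (sym (blockDiag-ul J _ a d))
      entry (lower b) (upper c) = trans (*-annihilateˡ _ (*-annihilateˡ _ (kept-↑ʳ b))) (sym (blockDiag-lu J _ b c))
      entry (lower b) (lower d) = trans (*-annihilateˡ _ (*-annihilateˡ _ (kept-↑ʳ b))) (sym (blockDiag-ll J _ b d))

  adjMatrix∼blockDiag : adjMatrix G ∼ blockDiag (completeGraphMatrix k) (λ _ _ → 0ℤ)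
  adjMatrix∼blockDiag =
    ∼-trans (∼-permute π (adjMatrix G))
      (∼-trans (∼-collapse M′ ρ-idem rowTwin colTwin) (∼-reflexive collapsed≐blockDiag))
    where
    ρ-idem : ∀ x → ρ (ρ x) ≡ ρ x
    ρ-idem x = cong (_↑ˡ m) (part′∘ρ x)
    rowTwin : ∀ x y → M′ (ρ x) y ≡ M′ x y
    rowTwin x y = trans (M′≡J (ρ x) y) (trans (cong (λ c → J c (part′ y)) (part′∘ρ x)) (sym (M′≡J x y)))
    colTwin : ∀ x y → M′ x (ρ y) ≡ M′ x y
    colTwin x y = trans (M′≡J x (ρ y)) (trans (cong (J (part′ x)) (part′∘ρ y)) (sym (M′≡J x y)))

completeMultipartite⇒SNFAtMostTwoOnes : ∀ {n k} {G : Graph n} → CompleteMultipartite G k → k ≤ 3 → SNFAtMostTwoOnes G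
completeMultipartite⇒SNFAtMostTwoOnes {k = k} multipartite k≤3
  with ℕ.m≤n⇒∃[o]m+o≡n (FinP.injective⇒≤ (CompleteMultipartite.representative-injective multipartite))
     | smithNormalForm-completeGraph k k≤3
... | m , refl | d , snf , ones≤2 =
  padded d , isSmithNormalForm-∼ (CompleteMultipartiteReduction.adjMatrix∼blockDiag multipartite) (isSmithNormalForm-padded d snf) ,
  subst (_≤ 2) (sym (numUnitInvariantFactors-padded d)) ones≤2

-- 3×3 minors

det₃ : Matrix 3 → ℤ
det₃ e = e 0F 0F * (e 1F 1F * e 2F 2F - e 1F 2F * e 2F 1F)
       - e 0F 1F * (e 1F 0F * e 2F 2F - e 1F 2F * e 2F 0F)
       + e 0F 2F * (e 1F 0F * e 2F 1F - e 1F 1F * e 2F 0F)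

det₃-rank≤2 : ∀ (x y z w : Fin 3 → ℤ) → det₃ (λ r c → x r * y c + z r * w c) ≡ 0ℤ
det₃-rank≤2 x y z w = expansion (x 0F) (x 1F) (x 2F) (y 0F) (y 1F) (y 2F) (z 0F) (z 1F) (z 2F) (w 0F) (w 1F) (w 2F)
  where
  expansion : ∀ x₀ x₁ x₂ y₀ y₁ y₂ z₀ z₁ z₂ w₀ w₁ w₂ →
    (x₀ * y₀ + z₀ * w₀) * ((x₁ * y₁ + z₁ * w₁) * (x₂ * y₂ + z₂ * w₂) - (x₁ * y₂ + z₁ * w₂) * (x₂ * y₁ + z₂ * w₁))
    - (x₀ * y₁ + z₀ * w₁) * ((x₁ * y₀ + z₁ * w₀) * (x₂ * y₂ + z₂ * w₂) - (x₁ * y₂ + z₁ * w₂) * (x₂ * y₀ + z₂ * w₀))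
    + (x₀ * y₂ + z₀ * w₂) * ((x₁ * y₀ + z₁ * w₀) * (x₂ * y₁ + z₂ * w₁) - (x₁ * y₁ + z₁ * w₁) * (x₂ * y₀ + z₂ * w₀)) ≡ 0ℤ
  expansion = solve-∀

module Congruence (m : ℤ) where

  infix 4 _≈_
  record _≈_ (a b : ℤ) : Set where
    constructor ≈-intro
    field m∣a-b : m ∣ₛ (a - b)
  open _≈_ public

  private
    +-difference : ∀ a b a' b' → (a + b) - (a' + b') ≡ (a - a') + (b - b')
    +-difference = solve-∀
    minus-difference : ∀ a b a' b' → (a - b) - (a' - b') ≡ (a - a') - (b - b')
    minus-difference = solve-∀
    *-difference : ∀ a b a' b' → (a * b) - (a' * b') ≡ a * (b - b') + (a - a') * b'
    *-difference = solve-∀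

  +-cong : ∀ {a b a' b'} → a ≈ a' → b ≈ b' → a + b ≈ a' + b'
  +-cong {a} {b} {a'} {b'} (≈-intro m∣a-a') (≈-intro m∣b-b') =
    ≈-intro (subst (m ∣ₛ_) (sym (+-difference a b a' b')) (∣m∣n⇒∣m+n m∣a-a' m∣b-b'))

  minus-cong : ∀ {a b a' b'} → a ≈ a' → b ≈ b' → a - b ≈ a' - b'
  minus-cong {a} {b} {a'} {b'} (≈-intro m∣a-a') (≈-intro m∣b-b') =
    ≈-intro (subst (m ∣ₛ_) (sym (minus-difference a b a' b')) (∣m∣n⇒∣m-n m∣a-a' m∣b-b'))

  *-cong : ∀ {a b a' b'} → a ≈ a' → b ≈ b' → a * b ≈ a' * b'
  *-cong {a} {b} {a'} {b'} (≈-intro m∣a-a') (≈-intro m∣b-b') =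
    ≈-intro (subst (m ∣ₛ_) (sym (*-difference a b a' b'))
                   (∣m∣n⇒∣m+n (∣n⇒∣m*n a m∣b-b') (∣m⇒∣m*n b' m∣a-a')))

  det₃-cong : ∀ {e e' : Matrix 3} → (∀ r c → e r c ≈ e' r c) → det₃ e ≈ det₃ e'
  det₃-cong {e} {e'} e≈e' =
    +-cong (minus-cong (*-cong (e≈e' 0F 0F) (cofactor 1F 2F 1F 2F)) (*-cong (e≈e' 0F 1F) (cofactor 1F 2F 0F 2F)))
           (*-cong (e≈e' 0F 2F) (cofactor 1F 2F 0F 1F))
    where
    cofactor : ∀ r r' c c' → e r c * e r' c' - e r c' * e r' c ≈ e' r c * e' r' c' - e' r c' * e' r' c
    cofactor r r' c c' = minus-cong (*-cong (e≈e' r c) (e≈e' r' c')) (*-cong (e≈e' r c') (e≈e' r' c))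

nonnegative∣1⇒≡1 : ∀ {a} → 0ℤ ℤ.≤ a → ∣ a ∣ ℕD.∣ 1 → a ≡ 1ℤ
nonnegative∣1⇒≡1 0≤a a∣1 = trans (sym (ℤ.0≤i⇒+∣i∣≡i 0≤a)) (cong +_ (ℕD.∣1⇒≡1 a∣1))

module _ {n : ℕ} {M : Matrix (3 ℕ.+ n)} {d : Fin (3 ℕ.+ n) → ℤ} (snf : IsSmithNormalForm M d) where

  open Congruence (d 2F)

  private
    decomposition : Σ (Matrix (3 ℕ.+ n)) λ P' → Σ (Matrix (3 ℕ.+ n)) λ Q' → M ≐ ((P' ⊗ diag d) ⊗ Q')
    decomposition = ∼-unfold (proj₂ (proj₂ snf))
    P' Q' : Matrix (3 ℕ.+ n)
    P' = proj₁ decomposition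
    Q' = proj₁ (proj₂ decomposition)

    tail : Fin (3 ℕ.+ n) → Fin (3 ℕ.+ n) → ℤ
    tail i j = sum (λ l → P' i (fs (fs l)) * d (fs (fs l)) * Q' (fs (fs l)) j)

    M-expansion : ∀ i j → M i j ≡ P' i 0F * d 0F * Q' 0F j + (P' i 1F * d 1F * Q' 1F j + tail i j)
    M-expansion i j = begin
      M i j                                   ≡⟨ proj₂ (proj₂ decomposition) i j ⟩
      ((P' ⊗ diag d) ⊗ Q') i j                ≡⟨ ⊗-sum (P' ⊗ diag d) Q' i j ⟩
      sum (λ l → (P' ⊗ diag d) i l * Q' l j)  ≡⟨ sum-cong-≗ (λ l → cong (_* Q' l j) (⊗-diag P' d i l)) ⟩
      sum (λ l → P' i l * d l * Q' l j)       ∎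
      where open ≡-Reasoning

    d₂∣tail : ∀ i j → d 2F ∣ₛ tail i j
    d₂∣tail i j = sum-∣ _ λ l → ∣m⇒∣m*n (Q' (fs (fs l)) j) (∣n⇒∣m*n (P' i (fs (fs l))) (d₂∣ l))
      where
      d₂∣ : ∀ l → d 2F ∣ₛ d (fs (fs l))
      d₂∣ l = ∣ᵤ⇒∣ (proj₁ (proj₂ snf) 2F (fs (fs l)) (s≤s (s≤s z≤n)))

    x z : Fin (3 ℕ.+ n) → ℤ
    x i = P' i 0F * d 0F
    z i = P' i 1F * d 1F

    ≈-rank≤2 : ∀ i j → M i j ≈ x i * Q' 0F j + z i * Q' 1F j
    ≈-rank≤2 i j = ≈-intro (subst (d 2F ∣ₛ_) (sym difference) (d₂∣tail i j))
      where
      cancel : ∀ a b t → (a + (b + t)) - (a + b) ≡ t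
      cancel = solve-∀
      difference : M i j - (x i * Q' 0F j + z i * Q' 1F j) ≡ tail i j
      difference = trans (cong (_- (x i * Q' 0F j + z i * Q' 1F j)) (M-expansion i j))
                         (cancel (x i * Q' 0F j) (z i * Q' 1F j) (tail i j))

  thirdInvariantFactor∣det₃ : ∀ (e : Matrix 3) (rows cols : Fin 3 → Fin (3 ℕ.+ n)) →
    (∀ r c → e r c ≡ M (rows r) (cols c)) → d 2F ∣ₛ det₃ e
  thirdInvariantFactor∣det₃ e rows cols e≡M = subst (d 2F ∣ₛ_) det₃e-0≡det₃e (m∣a-b (det₃-cong e≈rank≤2))
    where
    e≈rank≤2 : ∀ r c → e r c ≈ x (rows r) * Q' 0F (cols c) + z (rows r) * Q' 1F (cols c)
    e≈rank≤2 r c = subst (_≈ _) (sym (e≡M r c)) (≈-rank≤2 (rows r) (cols c))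
    det₃e-0≡det₃e : det₃ e - det₃ (λ r c → x (rows r) * Q' 0F (cols c) + z (rows r) * Q' 1F (cols c)) ≡ det₃ e
    det₃e-0≡det₃e =
      trans (cong (_-_ (det₃ e)) (det₃-rank≤2 (x ∘ rows) (Q' 0F ∘ cols) (z ∘ rows) (Q' 1F ∘ cols))) (+-identityʳ (det₃ e))

  unitDet₃⇒3≤numUnitInvariantFactors : ∀ (e : Matrix 3) (rows cols : Fin 3 → Fin (3 ℕ.+ n)) →
    (∀ r c → e r c ≡ M (rows r) (cols c)) → ∣ det₃ e ∣ ≡ 1 → 3 ≤ numUnitInvariantFactors d
  unitDet₃⇒3≤numUnitInvariantFactors e rows cols e≡M ∣det₃e∣≡1 =
    threeUnits⇒3≤numUnitInvariantFactors d (unit 0F z≤n) (unit 1F (s≤s z≤n)) (unit 2F (s≤s (s≤s z≤n)))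
    where
    d₂∣1 : ∣ d 2F ∣ ℕD.∣ 1
    d₂∣1 = subst (∣ d 2F ∣ ℕD.∣_) ∣det₃e∣≡1 (∣⇒∣ᵤ (thirdInvariantFactor∣det₃ e rows cols e≡M))
    unit : ∀ i → toℕ i ≤ 2 → d i ≡ 1ℤ
    unit i i≤2 = nonnegative∣1⇒≡1 (proj₁ snf i) (ℕD.∣-trans (proj₁ (proj₂ snf) i 2F i≤2) d₂∣1)

atMostTwoOnes⇒¬induced : ∀ {n} (G : Graph n) → SNFAtMostTwoOnes G →
  ∀ (H : Fin 4 → Fin 4 → Bool) (rows cols : Fin 3 → Fin 4) →
  ∣ det₃ (λ r c → indicator (H (rows r) (cols c))) ∣ ≡ 1 → ¬ InducedSubgraphOf H (adj G)
atMostTwoOnes⇒¬induced G (d , snf , ones≤2) H rows cols unitMinor (f , f-inj , embed) =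
  contradiction G d snf ones≤2 f (FinP.injective⇒≤ f-inj) embed
  where
  contradiction : ∀ {n} (G : Graph n) d → IsSmithNormalForm (adjMatrix G) d → numUnitInvariantFactors d ≤ 2 →
    (f : Fin 4 → Fin n) → 4 ≤ n → (∀ i j → adj G (f i) (f j) ≡ H i j) → ⊥
  contradiction {suc (suc (suc _))} G d snf ones≤2 f _ embed =
    ℕ.<⇒≱ (unitDet₃⇒3≤numUnitInvariantFactors {M = adjMatrix G} snf _ (f ∘ rows) (f ∘ cols)
             (λ r c → cong indicator (sym (embed (rows r) (cols c)))) unitMinor)
          ones≤2
  contradiction {suc (suc zero)} _ _ _ _ _ (s≤s (s≤s ())) _
  contradiction {suc zero}       _ _ _ _ _ (s≤s ()) _
  contradiction {zero}           _ _ _ _ _ () _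

-- Complete multipartite graphs and forbidden induced subgraphs

InducedInCompleteMultipartite : ∀ {n} (k : ℕ) → (Fin n → Fin n → Bool) → Set
InducedInCompleteMultipartite {n} k A = Σ (Fin n → Fin k) λ part → ∀ x y → A x y ≡ completeGraph k (part x) (part y)

induced-inCompleteMultipartite : ∀ {m n k} {H : Fin m → Fin m → Bool} {A : Fin n → Fin n → Bool} →
  InducedSubgraphOf H A → InducedInCompleteMultipartite k A → InducedInCompleteMultipartite k H
induced-inCompleteMultipartite (f , _ , embed) (part , A≡K) =
  part ∘ f , λ i j → trans (sym (embed i j)) (A≡K (f i) (f j))

inCompleteMultipartite-nonadjacency-trans : ∀ {n k} {A : Fin n → Fin n → Bool} → InducedInCompleteMultipartite k A →
  ∀ {x y z} → A x z ≡ false → A z y ≡ false → A x y ≡ false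
inCompleteMultipartite-nonadjacency-trans {A = A} (part , A≡K) {x} {y} {z} x≁z z≁y =
  trans (A≡K x y) (≡⇒completeGraph≡false (trans (samePart x≁z) (samePart z≁y)))
  where
  samePart : ∀ {u v} → A u v ≡ false → part u ≡ part v
  samePart {u} {v} u≁v = completeGraph≡false⇒≡ (trans (sym (A≡K u v)) u≁v)

P4-notInCompleteMultipartite : ∀ {k} → ¬ InducedInCompleteMultipartite k P4
P4-notInCompleteMultipartite multipartite
  with () ← inCompleteMultipartite-nonadjacency-trans multipartite {0F} {1F} {3F} refl refl

paw-notInCompleteMultipartite : ∀ {k} → ¬ InducedInCompleteMultipartite k paw
paw-notInCompleteMultipartite multipartite
  with () ← inCompleteMultipartite-nonadjacency-trans multipartite {1F} {2F} {3F} refl refl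

completeGraph-inCompleteMultipartite⇒≤ : ∀ {k l} → InducedInCompleteMultipartite k (completeGraph l) → l ≤ k
completeGraph-inCompleteMultipartite⇒≤ (part , K≡K) =
  FinP.injective⇒≤ λ {i} {j} eq → completeGraph≡false⇒≡ (trans (K≡K i j) (≡⇒completeGraph≡false eq))

K4-notInCompleteTripartite : ¬ InducedInCompleteMultipartite 3 K4
K4-notInCompleteTripartite multipartite with completeGraph-inCompleteMultipartite⇒≤ multipartite
... | s≤s (s≤s (s≤s ()))

completeMultipartite⇒inCompleteMultipartite : ∀ {n k l} {G : Graph n} → k ≤ l → CompleteMultipartite G k →
  InducedInCompleteMultipartite l (adj G)
completeMultipartite⇒inCompleteMultipartite k≤l multipartite =
  (λ x → Fin.inject≤ (part x) k≤l) ,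
  λ x y → trans (adj≡K x y) (cong not (sym (⌊≟⌋-injective (FinP.inject≤-injective k≤l k≤l _ _) (part x) (part y))))
  where open CompleteMultipartite multipartite

completeTripartite⇒inCompleteMultipartite : ∀ {n} (G : Graph n) → InducedSubgraphOfCompleteTripartite G →
  InducedInCompleteMultipartite 3 (adj G)
completeTripartite⇒inCompleteMultipartite G (a , b , c , _ , _ , _ , f , _ , embed) =
  part3 a b c ∘ f , λ x y → sym (embed x y)

module _ {n : ℕ} where

  private
    s : ℕ
    s = suc n

    place : Fin 3 → Fin n → Fin (s ℕ.+ s ℕ.+ s)
    place 0F x = (Fin.inject₁ x ↑ˡ s) ↑ˡ s
    place 1F x = (s ↑ʳ Fin.inject₁ x) ↑ˡ s
    place 2F x = (s ℕ.+ s) ↑ʳ Fin.inject₁ x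

    part3-place : ∀ k x → part3 s s s (place k x) ≡ k
    part3-place 0F x
      rewrite FinP.splitAt-↑ˡ (s ℕ.+ s) (Fin.inject₁ x ↑ˡ s) s | FinP.splitAt-↑ˡ s (Fin.inject₁ x) s = refl
    part3-place 1F x
      rewrite FinP.splitAt-↑ˡ (s ℕ.+ s) (s ↑ʳ Fin.inject₁ x) s | FinP.splitAt-↑ʳ s s (Fin.inject₁ x) = refl
    part3-place 2F x rewrite FinP.splitAt-↑ʳ (s ℕ.+ s) s (Fin.inject₁ x) = refl

    place-injective : ∀ k {x y} → place k x ≡ place k y → x ≡ y
    place-injective 0F eq = FinP.inject₁-injective (FinP.↑ˡ-injective s _ _ (FinP.↑ˡ-injective s _ _ eq))
    place-injective 1F eq = FinP.inject₁-injective (FinP.↑ʳ-injective s _ _ (FinP.↑ˡ-injective s _ _ eq))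
    place-injective 2F eq = FinP.inject₁-injective (FinP.↑ʳ-injective (s ℕ.+ s) _ _ eq)

  -- Each vertex goes into its own slot of a part of K_{n+1,n+1,n+1}.
  inCompleteMultipartite⇒completeTripartite : (G : Graph n) → InducedInCompleteMultipartite 3 (adj G) →
    InducedSubgraphOfCompleteTripartite G
  inCompleteMultipartite⇒completeTripartite G (part , A≡K) =
    s , s , s , s≤s z≤n , s≤s z≤n , s≤s z≤n , f , f-injective , embed
    where
    f : Fin n → Fin (s ℕ.+ s ℕ.+ s)
    f x = place (part x) x
    embed : ∀ x y → completeTripartite s s s (f x) (f y) ≡ adj G x y
    embed x y = trans (cong₂ (completeGraph 3) (part3-place (part x) x) (part3-place (part y) y)) (sym (A≡K x y))
    f-injective : Injective _≡_ _≡_ f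
    f-injective {x} {y} eq = place-injective (part y) (subst (λ k → place k x ≡ f y) same-part eq)
      where
      same-part : part x ≡ part y
      same-part = trans (sym (part3-place (part x) x)) (trans (cong (part3 s s s) eq) (part3-place (part y) y))

walk-leaves : ∀ {n} (G : Graph n) (S : Fin n → Bool) {x y} → Walk G x y → S x ≡ true → S y ≡ false →
  Σ (Fin n) λ u → Σ (Fin n) λ v → adj G u v ≡ true × S u ≡ true × S v ≡ false
walk-leaves G S here Sx Sy with () ← trans (sym Sx) Sy
walk-leaves G S {x} (step {j = j} x~j walk) Sx Sy with S j in Sj
... | true  = walk-leaves G S walk Sj Sy
... | false = x , j , x~j , Sx , Sj

symmetric? : ∀ {m} (H : Fin m → Fin m → Bool) → Dec (∀ i j → H i j ≡ H j i)
symmetric? H = FinP.all? λ i → FinP.all? λ j → H i j Bool.≟ H j i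

irreflexive? : ∀ {m} (H : Fin m → Fin m → Bool) → Dec (∀ i → H i i ≡ false)
irreflexive? H = FinP.all? λ i → H i i Bool.≟ false

DistinctRows : ∀ {m} → (Fin m → Fin m → Bool) → Set
DistinctRows {m} H = ∀ (i j : Fin m) → i ≡ j ⊎ ∃ λ k → H i k ≢ H j k

distinctRows? : ∀ {m} (H : Fin m → Fin m → Bool) → Dec (DistinctRows H)
distinctRows? H = FinP.all? λ i → FinP.all? λ j → (i FinP.≟ j) ⊎-dec FinP.any? (λ k → ¬? (H i k Bool.≟ H j k))

induced₄ : ∀ {n} (G : Graph n) (H : Fin 4 → Fin 4 → Bool)
  {_ : True (symmetric? H)} {_ : True (irreflexive? H)} {_ : True (distinctRows? H)} (v₀ v₁ v₂ v₃ : Fin n) →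
  adj G v₀ v₁ ≡ H 0F 1F → adj G v₀ v₂ ≡ H 0F 2F → adj G v₀ v₃ ≡ H 0F 3F →
  adj G v₁ v₂ ≡ H 1F 2F → adj G v₁ v₃ ≡ H 1F 3F → adj G v₂ v₃ ≡ H 2F 3F →
  InducedSubgraphOf H (adj G)
induced₄ {n} G H {H-sym} {H-irrefl} {H-distinctRows} v₀ v₁ v₂ v₃ e₀₁ e₀₂ e₀₃ e₁₂ e₁₃ e₂₃ =
  v , v-injective , embed
  where
  v : Fin 4 → Fin n
  v = Vec.lookup (v₀ ∷ v₁ ∷ v₂ ∷ v₃ ∷ [])
  flip : ∀ i j → adj G (v i) (v j) ≡ H i j → adj G (v j) (v i) ≡ H j i
  flip i j e = trans (Graph.sym G (v j) (v i)) (trans e (toWitness H-sym i j))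
  loop : ∀ i → adj G (v i) (v i) ≡ H i i
  loop i = trans (irrefl G (v i)) (sym (toWitness H-irrefl i))
  embed : ∀ i j → adj G (v i) (v j) ≡ H i j
  embed 0F 0F = loop 0F
  embed 0F 1F = e₀₁
  embed 0F 2F = e₀₂
  embed 0F 3F = e₀₃
  embed 1F 0F = flip 0F 1F e₀₁
  embed 1F 1F = loop 1F
  embed 1F 2F = e₁₂
  embed 1F 3F = e₁₃
  embed 2F 0F = flip 0F 2F e₀₂
  embed 2F 1F = flip 1F 2F e₁₂
  embed 2F 2F = loop 2F
  embed 2F 3F = e₂₃
  embed 3F 0F = flip 0F 3F e₀₃
  embed 3F 1F = flip 1F 3F e₁₃
  embed 3F 2F = flip 2F 3F e₂₃
  embed 3F 3F = loop 3F
  v-injective : Injective _≡_ _≡_ v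
  v-injective {i} {j} vi≡vj with toWitness H-distinctRows i j
  ... | inj₁ i≡j = i≡j
  ... | inj₂ (k , Hik≢Hjk) =
    ⊥-elim (Hik≢Hjk (trans (sym (embed i k)) (trans (cong (λ w → adj G w (v k)) vi≡vj) (embed j k))))

NonadjacencyTransitive : ∀ {n} → Graph n → Set
NonadjacencyTransitive G = ∀ {x y z} → adj G x z ≡ false → adj G z y ≡ false → adj G x y ≡ false

nor-false : ∀ a b → not (a Bool.∨ b) ≡ true → a ≡ false × b ≡ false
nor-false false false _ = refl , refl

connected⇒nonadjacencyTransitive : ∀ {n} (G : Graph n) → Connected G →
  ¬ InducedSubgraphOf P4 (adj G) → ¬ InducedSubgraphOf paw (adj G) → NonadjacencyTransitive G
connected⇒nonadjacencyTransitive {n} G connected noP4 noPaw {x} {y} {z} x≁z z≁y with adj G x y in x~y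
... | false = refl
... | true  with walk-leaves G S (connected z x) Sz Sx
  where
  S : Fin n → Bool
  S w = not (adj G w x Bool.∨ adj G w y)
  Sz : S z ≡ true
  Sz rewrite Graph.sym G z x | x≁z | z≁y = refl
  Sx : S x ≡ false
  Sx rewrite irrefl G x | x~y = refl
... | u , v , u~v , Su , Sv with nor-false (adj G u x) (adj G u y) Su | adj G v x in v~x | adj G v y in v~y
...   | u≁x , u≁y | true  | true  = ⊥-elim (noPaw (induced₄ G paw v x y u v~x v~y (trans (Graph.sym G v u) u~v) x~y
                                       (trans (Graph.sym G x u) u≁x) (trans (Graph.sym G y u) u≁y)))
...   | u≁x , u≁y | true  | false = ⊥-elim (noP4 (induced₄ G P4 u v x y u~v u≁x u≁y v~x v~y x~y))
...   | u≁x , u≁y | false | true  = ⊥-elim (noP4 (induced₄ G P4 u v y x u~v u≁y u≁x v~y v~x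
                                       (trans (Graph.sym G y x) x~y)))
...   | _         | false | false = case Sv of λ ()

module _ {n : ℕ} (G : Graph n) where

  Clique : ∀ {k} → (Fin k → Fin n) → Set
  Clique {k} r = ∀ c d → adj G (r c) (r d) ≡ completeGraph k c d

  Dominating : ∀ {k} → (Fin k → Fin n) → Set
  Dominating r = ∀ x → ∃ λ c → adj G x (r c) ≡ false

  clique-∷ : ∀ {k} {r : Fin k → Fin n} {x} → Clique r → (∀ c → adj G x (r c) ≡ true) → Clique (x ∷ᶠ r)
  clique-∷ {x = x} r-clique x~r fz     fz     = irrefl G x
  clique-∷         r-clique x~r fz     (fs d) = x~r d
  clique-∷ {r = r} {x} r-clique x~r (fs c) fz = trans (Graph.sym G (r c) x) (x~r c)
  clique-∷         r-clique x~r (fs c) (fs d) = trans (r-clique c d) (cong not (sym (⌊≟⌋-injective FinP.suc-injective c d)))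

  clique⇒induced : ∀ {k} {r : Fin k → Fin n} → Clique r → InducedSubgraphOf (completeGraph k) (adj G)
  clique⇒induced {r = r} r-clique = r , r-injective , r-clique
    where
    r-injective : Injective _≡_ _≡_ r
    r-injective {c} {d} rc≡rd =
      completeGraph≡false⇒≡ (trans (sym (r-clique c d)) (trans (cong (adj G (r c)) (sym rc≡rd)) (irrefl G (r c))))

  extension? : ∀ {k} (r : Fin k → Fin n) → Dec (∃ λ x → ∀ c → adj G x (r c) ≡ true)
  extension? r = FinP.any? λ x → FinP.all? λ c → adj G x (r c) Bool.≟ true

  ¬extension⇒dominating : ∀ {k} (r : Fin k → Fin n) → ¬ (∃ λ x → ∀ c → adj G x (r c) ≡ true) → Dominating r
  ¬extension⇒dominating {k} r ¬extension x =
    let c , x≁rc = FinP.¬∀⟶∃¬ k _ (λ c → adj G x (r c) Bool.≟ true) (λ x~r → ¬extension (x , x~r))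
    in  c , BoolP.¬-not x≁rc

  -- j bounds how many vertices the clique can still gain before it would induce a K4.
  maximalClique : ¬ InducedSubgraphOf K4 (adj G) → ∀ j {k} (r : Fin k → Fin n) → Clique r → j ℕ.+ k ≡ 3 →
    Σ ℕ λ k → k ≤ 3 × Σ (Fin k → Fin n) λ r → Clique r × Dominating r
  maximalClique noK4 j {k} r r-clique j+k≡3 with extension? r
  ... | no ¬extension = k , subst (k ≤_) j+k≡3 (ℕ.m≤n+m k j) , r , r-clique , ¬extension⇒dominating r ¬extension
  ... | yes (x , x~r) with j | j+k≡3
  ...   | zero  | refl    = ⊥-elim (noK4 (clique⇒induced (clique-∷ r-clique x~r)))
  ...   | suc j | j+k≡3′ = maximalClique noK4 j (x ∷ᶠ r) (clique-∷ r-clique x~r) (trans (ℕ.+-suc j k) j+k≡3′)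

  dominatingClique⇒completeMultipartite : NonadjacencyTransitive G → ∀ {k} {r : Fin k → Fin n} →
    Clique r → Dominating r → CompleteMultipartite G k
  dominatingClique⇒completeMultipartite ≁-trans {k} {r} r-clique r-dominating = record
    { part = part ; representative = r ; adj≡K = adj≡K ; part∘rep = part∘rep }
    where
    part : Fin n → Fin k
    part x = proj₁ (r-dominating x)
    x≁r[part] : ∀ x → adj G x (r (part x)) ≡ false
    x≁r[part] x = proj₂ (r-dominating x)
    ≁-sym : ∀ {x y} → adj G x y ≡ false → adj G y x ≡ false
    ≁-sym {x} {y} x≁y = trans (Graph.sym G y x) x≁y
    part∘rep : ∀ c → part (r c) ≡ c
    part∘rep c = sym (completeGraph≡false⇒≡ (trans (sym (r-clique c (part (r c)))) (x≁r[part] (r c))))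
    adj≡K : ∀ x y → adj G x y ≡ completeGraph k (part x) (part y)
    adj≡K x y with part x FinP.≟ part y
    ... | yes same = ≁-trans (x≁r[part] x) (≁-sym (subst (λ c → adj G y (r c) ≡ false) (sym same) (x≁r[part] y)))
    ... | no different with adj G x y in x~y
    ...   | true  = refl
    ...   | false = ⊥-elim (different (completeGraph≡false⇒≡ (trans (sym (r-clique (part x) (part y)))
                      (≁-trans (≁-sym (x≁r[part] x)) (≁-trans x~y (x≁r[part] y))))))

ForbiddenFree : ∀ {n} → Graph n → Set
ForbiddenFree G = ¬ InducedSubgraphOf P4 (adj G) × ¬ InducedSubgraphOf paw (adj G) × ¬ InducedSubgraphOf K4 (adj G)

forbiddenFree⇒completeMultipartite : ∀ {n} (G : Graph n) → Connected G → ForbiddenFree G →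
  Σ ℕ λ k → k ≤ 3 × CompleteMultipartite G k
forbiddenFree⇒completeMultipartite G connected (noP4 , noPaw , noK4)
  with maximalClique G noK4 3 {0} (λ ()) (λ ()) refl
... | k , k≤3 , r , r-clique , r-dominating =
  k , k≤3 , dominatingClique⇒completeMultipartite G ≁-trans r-clique r-dominating
  where
  ≁-trans : NonadjacencyTransitive G
  ≁-trans = connected⇒nonadjacencyTransitive G connected noP4 noPaw

mainTheorem6 : ∀ {n : ℕ} (G : Graph n) → Connected G →
    (SNFAtMostTwoOnes G ⇔
      (¬ InducedSubgraphOf P4 (adj G) × ¬ InducedSubgraphOf paw (adj G) × ¬ InducedSubgraphOf K4 (adj G)))
    × ((¬ InducedSubgraphOf P4 (adj G) × ¬ InducedSubgraphOf paw (adj G) × ¬ InducedSubgraphOf K4 (adj G))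
      ⇔ InducedSubgraphOfCompleteTripartite G)
mainTheorem6 G connected = mk⇔ snf⇒free free⇒snf , mk⇔ free⇒tripartite tripartite⇒free
  where
  snf⇒free : SNFAtMostTwoOnes G → ForbiddenFree G
  snf⇒free snf = atMostTwoOnes⇒¬induced G snf P4 Fin.inject₁ fs refl ,
                 atMostTwoOnes⇒¬induced G snf paw fs Fin.inject₁ refl ,
                 atMostTwoOnes⇒¬induced G snf K4 Fin.inject₁ fs refl
  free⇒snf : ForbiddenFree G → SNFAtMostTwoOnes G
  free⇒snf free with forbiddenFree⇒completeMultipartite G connected free
  ... | k , k≤3 , multipartite = completeMultipartite⇒SNFAtMostTwoOnes multipartite k≤3
  free⇒tripartite : ForbiddenFree G → InducedSubgraphOfCompleteTripartite G
  free⇒tripartite free with forbiddenFree⇒completeMultipartite G connected free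
  ... | k , k≤3 , multipartite =
    inCompleteMultipartite⇒completeTripartite G (completeMultipartite⇒inCompleteMultipartite k≤3 multipartite)
  tripartite⇒free : InducedSubgraphOfCompleteTripartite G → ForbiddenFree G
  tripartite⇒free tripartite =
    (λ P4⊆G → P4-notInCompleteMultipartite (induced-inCompleteMultipartite P4⊆G multipartite)) ,
    (λ paw⊆G → paw-notInCompleteMultipartite (induced-inCompleteMultipartite paw⊆G multipartite)) ,
    (λ K4⊆G → K4-notInCompleteTripartite (induced-inCompleteMultipartite K4⊆G multipartite))
    where
    multipartite : InducedInCompleteMultipartite 3 (adj G)
    multipartite = completeTripartite⇒inCompleteMultipartite G tripartite
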